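{- Let $q$ be an odd prime power with $q>5$, and let $a,b\in\mathbb{F}_q$ with $a\neq 0$. Then \[ S(X^4+aX^2+b) = -\Bigl(\frac{4+\chi(-1)+4\chi(-2a)}{64}\Bigr)\cdot a^2 + \Bigl(\frac{4+\chi(-1)-2\chi(-a)+2\chi(-2a)}{8}\Bigr)\cdot b . \]
   Context: For $f(X)\in\mathbb{F}_q[X]$, $f(\mathbb{F}_q):=\{f(x):x\in\mathbb{F}_q\}$ is the value set (a set, without multiplicity) and $S(f)$ denotes the sum of the elements of $f(\mathbb{F}_q)$. For odd $q$, $\chi$ is the quadratic character on $\mathbb{F}_q$: $\chi(x):=x^{(q-1)/2}$, so $\chi(x)=1$ for nonzero squares, $-1$ for nonsquares, $\chi(0)=0$. Rational numbers are interpreted in $\mathbb{F}_q$. -}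

module Defs where

open import Level using (Level; suc; _⊔_)
open import Data.Nat as ℕ using (ℕ; zero; suc)
open import Data.Nat.DivMod using (_/_)
open import Data.List using (List; []; _∷_; length; filter; foldr)
open import Data.List.Membership.Propositional using (_∈_)
open import Data.List.Relation.Unary.Unique.Propositional using (Unique)
open import Data.List.Relation.Unary.Any using (any?)
open import Relation.Nullary using (¬_; Dec)
open import Relation.Binary.PropositionalEquality using (_≡_)
open import Relation.Binary.Definitions using (DecidableEquality)
open import Algebra.Structures using (IsCommutativeRing)

record FiniteField ℓ : Set (Level.suc ℓ) where
  infixl 7 _*_
  infixl 6 _+_
  infix 8 -_
  field
    Carrier : Set ℓ
    _+_ _*_ : Carrier → Carrier → Carrier
    -_ : Carrier → Carrier
    0# 1# : Carrier
    isCommutativeRing : IsCommutativeRing _≡_ _+_ _*_ -_ 0# 1#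
    _≟_ : DecidableEquality Carrier
    0≢1 : ¬ (0# ≡ 1#)
    _⁻¹ : Carrier → Carrier
    inverseʳ : ∀ x → ¬ (x ≡ 0#) → x * (x ⁻¹) ≡ 1#
    elements : List Carrier
    complete : ∀ x → x ∈ elements
    unique : Unique elements

  size : ℕ
  size = length elements

  fromℕ : ℕ → Carrier
  fromℕ zero = 0#
  fromℕ (suc n) = 1# + fromℕ n

  infixr 8 _^_
  _^_ : Carrier → ℕ → Carrier
  x ^ zero = 1#
  x ^ suc n = x * (x ^ n)

  χ : Carrier → Carrier
  χ x = x ^ ((size ℕ.∸ 1) / 2)

  sumList : List Carrier → Carrier
  sumList = foldr _+_ 0#

  valueSet : (Carrier → Carrier) → List Carrier
  valueSet f = filter (λ y → any? (λ x → f x ≟ y) elements) elements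

  S : (Carrier → Carrier) → Carrier
  S f = sumList (valueSet f)

module Submission where

-- With h = a/2 and c = b - h², f(x) = (x² + h)² + c, so y is a value of f iff
-- y - c = u² with u - h or - u - h a square. Counting square roots turns S(f)
-- into a sum over u of (u² + c) times the indicator of that union, and writing
-- the indicator of the squares as (1 + χ + δ₀)/2 reduces everything to
-- character sums. Sums of χ against quadratics vanish because the power sums
-- ∑ xᵐ vanish for 0 < m < q - 1 (here q > 5 is used); what survives are the
-- point masses at u = ± h and the Jacobsthal sum ∑ χ(z (h² - z)) = - χ(-1).

open import Defs
open import Level using (Level)
open import Algebra.Bundles using (CommutativeRing; CommutativeSemigroup; Semiring)
open import Algebra.Structures using (IsCommutativeMonoid; IsCommutativeRing)
open import Algebra.Core using (Op₂)
import Algebra.Properties.CommutativeSemigroup as CommutativeSemigroupProperties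
import Algebra.Properties.Ring as RingProperties
import Algebra.Properties.Semiring.Mult as SemiringMultProperties
import Algebra.Definitions.RawSemiring as RawSemiringDefinitions
import Algebra.Solver.Ring
open import Algebra.Solver.Ring.AlmostCommutativeRing
  using (_-Raw-AlmostCommutative⟶_; fromCommutativeRing)
open import Data.Nat using (ℕ; zero; suc; z≤n; s≤s; _>_; _≥_; _%_)
import Data.Nat as ℕ
import Data.Nat.Properties as ℕ
open import Data.Nat.DivMod using (_/_; m≡m%n+[m/n]*n; m*n/n≡m)
open import Data.Nat.Primality using (Prime)
open import Data.Integer as ℤ using (ℤ; -[1+_]; _⊖_)
import Data.Integer.Properties as ℤ
open import Data.Sign as Sign using (Sign)
open import Data.Maybe using (Maybe; just; nothing)
open import Data.List using (List; []; _∷_; length; filter)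
open import Data.List.Membership.Propositional using (_∈_; find)
open import Data.List.Membership.Propositional.Properties using (∈-filter⁺; ∈-filter⁻)
open import Data.List.Relation.Unary.Any as Any using (here; there; any?)
open import Data.List.Relation.Unary.All as All using (All; []; _∷_; all?)
open import Data.List.Relation.Unary.All.Properties.Core using (¬All⇒Any¬)
open import Data.List.Relation.Unary.AllPairs using (_∷_)
open import Data.List.Relation.Unary.Unique.Propositional using (Unique)
import Data.List.Relation.Unary.Unique.Propositional.Properties as Unique
open import Data.Product using (Σ-syntax; ∃; _×_; _,_; proj₁; proj₂)
open import Data.Sum using (_⊎_; inj₁; inj₂; [_,_]′)
open import Data.Empty using (⊥; ⊥-elim)
open import Relation.Nullary using (Dec; yes; no; ¬_; ¬?)
open import Relation.Nullary.Decidable using (map′; _×-dec_)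
open import Relation.Unary using (Pred; Decidable)
open import Relation.Binary.Definitions using (DecidableEquality)
open import Relation.Binary.PropositionalEquality
  using (_≡_; refl; sym; trans; cong; cong₂; subst; module ≡-Reasoning)

module FiniteSum {a} {M : Set a} {_∙_ : Op₂ M} {ε : M}
                 (isCommutativeMonoid : IsCommutativeMonoid _≡_ _∙_ ε) where
  open IsCommutativeMonoid isCommutativeMonoid using (identityˡ; identityʳ; isCommutativeSemigroup)

  commutativeSemigroup : CommutativeSemigroup a a
  commutativeSemigroup = record { isCommutativeSemigroup = isCommutativeSemigroup }

  open CommutativeSemigroupProperties commutativeSemigroup using (interchange)

  ∑ : ∀ {b} {A : Set b} → List A → (A → M) → M
  ∑ []       f = ε
  ∑ (x ∷ xs) f = f x ∙ ∑ xs f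

  when : ∀ {p} {P : Set p} → Dec P → M → M
  when (yes _) m = m
  when (no _)  m = ε

  when-yes : ∀ {p} {P : Set p} (P? : Dec P) → P → ∀ m → when P? m ≡ m
  when-yes (yes _) _ m = refl
  when-yes (no ¬p) p m = ⊥-elim (¬p p)

  when-no : ∀ {p} {P : Set p} (P? : Dec P) → ¬ P → ∀ m → when P? m ≡ ε
  when-no (yes p) ¬p m = ⊥-elim (¬p p)
  when-no (no _)  ¬p m = refl

  when-cong : ∀ {p q} {P : Set p} {Q : Set q} (P? : Dec P) (Q? : Dec Q) →
              (P → Q) → (Q → P) → ∀ m → when P? m ≡ when Q? m
  when-cong (yes p) Q? P→Q Q→P m = sym (when-yes Q? (P→Q p) m)
  when-cong (no ¬p) Q? P→Q Q→P m = sym (when-no Q? (λ q → ¬p (Q→P q)) m)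

  when-⊎ : ∀ {p q r} {P : Set p} {Q : Set q} {R : Set r} (P? : Dec P) (Q? : Dec Q) (R? : Dec R) →
           (P → Q ⊎ R) → (Q → P) → (R → P) → (Q → R → ⊥) → ∀ m → when P? m ≡ when Q? m ∙ when R? m
  when-⊎ P? (yes q) (yes r) _ _ _ disjoint m = ⊥-elim (disjoint q r)
  when-⊎ P? (yes q) (no _)  _ Q→P _ _ m = trans (when-yes P? (Q→P q) m) (sym (identityʳ m))
  when-⊎ P? (no _)  (yes r) _ _ R→P _ m = trans (when-yes P? (R→P r) m) (sym (identityˡ m))
  when-⊎ P? (no ¬q) (no ¬r) P→Q⊎R _ _ _ m =
    trans (when-no P? (λ p → [ ¬q , ¬r ]′ (P→Q⊎R p)) m) (sym (identityˡ ε))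

  module _ {b} {A : Set b} where

    ∑-cong-∈ : ∀ xs {f g : A → M} → (∀ x → x ∈ xs → f x ≡ g x) → ∑ xs f ≡ ∑ xs g
    ∑-cong-∈ []       f≗g = refl
    ∑-cong-∈ (x ∷ xs) f≗g = cong₂ _∙_ (f≗g x (here refl)) (∑-cong-∈ xs (λ y y∈ → f≗g y (there y∈)))

    ∑-cong : ∀ xs {f g : A → M} → (∀ x → f x ≡ g x) → ∑ xs f ≡ ∑ xs g
    ∑-cong xs f≗g = ∑-cong-∈ xs (λ x _ → f≗g x)

    ∑-distrib : ∀ xs (f g : A → M) → ∑ xs (λ x → f x ∙ g x) ≡ ∑ xs f ∙ ∑ xs g
    ∑-distrib []       f g = sym (identityˡ ε)
    ∑-distrib (x ∷ xs) f g = trans (cong ((f x ∙ g x) ∙_) (∑-distrib xs f g)) (interchange _ _ _ _)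

    ∑-ε : ∀ xs → ∑ xs (λ (_ : A) → ε) ≡ ε
    ∑-ε []       = refl
    ∑-ε (x ∷ xs) = trans (identityˡ _) (∑-ε xs)

    ∑-vanishing : ∀ xs (f : A → M) → (∀ x → x ∈ xs → f x ≡ ε) → ∑ xs f ≡ ε
    ∑-vanishing xs f f≗ε = trans (∑-cong-∈ xs f≗ε) (∑-ε xs)

    ∑-when-unique : ∀ {p} {P : Pred A p} (P? : Decidable P) xs → Unique xs →
                    ∀ v → v ∈ xs → P v → (∀ x → P x → x ≡ v) →
                    (g : A → M) → ∑ xs (λ x → when (P? x) (g x)) ≡ g v
    ∑-when-unique P? (x ∷ xs) (x∉xs ∷ xs!) v v∈ Pv unique g with P? x
    ... | yes Px with refl ← unique x Px =
      trans (cong (g x ∙_) (∑-vanishing xs _ rest)) (identityʳ _)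
      where
      rest : ∀ y → y ∈ xs → when (P? y) (g y) ≡ ε
      rest y y∈ = when-no (P? y) (λ Py → All.lookup x∉xs y∈ (sym (unique y Py))) (g y)
    ... | no ¬Px with v∈
    ...   | here refl = ⊥-elim (¬Px Pv)
    ...   | there v∈xs = trans (identityˡ _) (∑-when-unique P? xs xs! v v∈xs Pv unique g)

  ∑-comm : ∀ {b c} {A : Set b} {B : Set c} (xs : List A) (ys : List B) (f : A → B → M) →
           ∑ xs (λ x → ∑ ys (f x)) ≡ ∑ ys (λ y → ∑ xs (λ x → f x y))
  ∑-comm []       ys f = sym (∑-ε ys)
  ∑-comm (x ∷ xs) ys f =
    trans (cong (∑ ys (f x) ∙_) (∑-comm xs ys f)) (sym (∑-distrib ys (f x) (λ y → ∑ xs (λ x → f x y))))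

  module OverFinite {b} {A : Set b} (_≟_ : DecidableEquality A)
                    (elements : List A) (unique : Unique elements) (complete : ∀ x → x ∈ elements) where

    ∑ₐ : (A → M) → M
    ∑ₐ = ∑ elements

    ∑-when-≡ : ∀ v (g : A → M) → ∑ₐ (λ x → when (x ≟ v) (g x)) ≡ g v
    ∑-when-≡ v g = ∑-when-unique (_≟ v) elements unique v (complete v) refl (λ x x≡v → x≡v) g

    -- Both sides equal ∑ over pairs (x , y) with y ≡ s x of f y.
    ∑-reindex : ∀ (s t : A → A) → (∀ x → t (s x) ≡ x) → (∀ y → s (t y) ≡ y) →
                (f : A → M) → ∑ₐ (λ x → f (s x)) ≡ ∑ₐ f
    ∑-reindex s t ts st f = begin
      ∑ₐ (λ x → f (s x))                             ≡⟨ ∑-cong elements (λ x → sym (∑-when-≡ (s x) f)) ⟩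
      ∑ₐ (λ x → ∑ₐ (λ y → when (y ≟ s x) (f y)))    ≡⟨ ∑-comm elements elements _ ⟩
      ∑ₐ (λ y → ∑ₐ (λ x → when (y ≟ s x) (f y)))    ≡⟨ ∑-cong elements fibre ⟩
      ∑ₐ f                                           ∎
      where
      open ≡-Reasoning
      fibre : ∀ y → ∑ₐ (λ x → when (y ≟ s x) (f y)) ≡ f y
      fibre y = ∑-when-unique (λ x → y ≟ s x) elements unique (t y) (complete (t y))
                  (sym (st y)) (λ x y≡sx → trans (sym (ts x)) (cong t (sym y≡sx))) (λ _ → f y)

    ∑-when-pair : ∀ {p} {P : Pred A p} (P? : Decidable P) v w → ¬ (v ≡ w) → P v → P w →
                  (∀ x → P x → x ≡ v ⊎ x ≡ w) → ∀ m → ∑ₐ (λ x → when (P? x) m) ≡ m ∙ m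
    ∑-when-pair P? v w v≢w Pv Pw P⊆v∪w m = begin
      ∑ₐ (λ x → when (P? x) m)
        ≡⟨ ∑-cong elements split ⟩
      ∑ₐ (λ x → when (x ≟ v) m ∙ when (x ≟ w) m)
        ≡⟨ ∑-distrib elements _ _ ⟩
      ∑ₐ (λ x → when (x ≟ v) m) ∙ ∑ₐ (λ x → when (x ≟ w) m)
        ≡⟨ cong₂ _∙_ (∑-when-≡ v (λ _ → m)) (∑-when-≡ w (λ _ → m)) ⟩
      m ∙ m ∎
      where
      open ≡-Reasoning
      split : ∀ x → when (P? x) m ≡ when (x ≟ v) m ∙ when (x ≟ w) m
      split x = when-⊎ (P? x) (x ≟ v) (x ≟ w) (P⊆v∪w x) (λ { refl → Pv }) (λ { refl → Pw })
                  (λ x≡v x≡w → v≢w (trans (sym x≡v) x≡w)) m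

module IntegerCoefficientSolver {c} {R : Set c} {add mul : Op₂ R} {neg : R → R} {0ʳ 1ʳ : R}
  (isCommutativeRing : IsCommutativeRing _≡_ add mul neg 0ʳ 1ʳ) where
  commutativeRing : CommutativeRing c c
  commutativeRing = record { isCommutativeRing = isCommutativeRing }
  open CommutativeRing commutativeRing
    using (_+_; _*_; -_; 0#; 1#; +-assoc; +-comm; +-identityˡ; +-identityʳ; *-assoc; *-comm; *-identityˡ; zeroʳ; -‿inverseˡ; -‿inverseʳ; ring; semiring)
  open Semiring semiring using (rawSemiring)
  open RingProperties ring using (-‿distribˡ-*; -‿distribʳ-*; -‿involutive; -‿+-comm; -0#≈0#)
  open RawSemiringDefinitions rawSemiring using () renaming (_×_ to _·_)
  open SemiringMultProperties semiring using (×-homo-+; ×1-homo-*)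
  open ≡-Reasoning

  signed : Sign → R → R
  signed Sign.+ x = x
  signed Sign.- x = - x

  fromℤ : ℤ → R
  fromℤ (ℤ.+ n)    = n · 1#
  fromℤ -[1+ n ] = - (suc n · 1#)

  fromℤ-◃ : ∀ s n → fromℤ (s ℤ.◃ n) ≡ signed s (n · 1#)
  fromℤ-◃ Sign.+ zero    = refl
  fromℤ-◃ Sign.- zero    = sym -0#≈0#
  fromℤ-◃ Sign.+ (suc n) = refl
  fromℤ-◃ Sign.- (suc n) = refl

  signed-abs : ∀ i → fromℤ i ≡ signed (ℤ.sign i) (ℤ.∣ i ∣ · 1#)
  signed-abs (ℤ.+ n)    = refl
  signed-abs -[1+ n ] = refl

  signed-* : ∀ s t x y → signed (s Sign.* t) (x * y) ≡ signed s x * signed t y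
  signed-* Sign.+ Sign.+ x y = refl
  signed-* Sign.+ Sign.- x y = -‿distribʳ-* x y
  signed-* Sign.- Sign.+ x y = -‿distribˡ-* x y
  signed-* Sign.- Sign.- x y = trans (sym (-‿involutive _)) (trans (cong -_ (-‿distribʳ-* x y)) (-‿distribˡ-* x (- y)))

  fromℤ-⊖ : ∀ m n → fromℤ (m ⊖ n) ≡ m · 1# + - (n · 1#)
  fromℤ-⊖ zero    zero    = sym (-‿inverseʳ 0#)
  fromℤ-⊖ (suc m) zero    = sym (trans (cong ((suc m · 1#) +_) -0#≈0#) (+-identityʳ _))
  fromℤ-⊖ zero    (suc n) = sym (+-identityˡ _)
  fromℤ-⊖ (suc m) (suc n) = begin
    fromℤ (suc m ⊖ suc n)                    ≡⟨ cong fromℤ (ℤ.[1+m]⊖[1+n]≡m⊖n m n) ⟩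
    fromℤ (m ⊖ n)                            ≡⟨ fromℤ-⊖ m n ⟩
    m · 1# + - (n · 1#)                      ≡⟨ cong (_+ - (n · 1#)) (sym (trans (cong (_+ m · 1#) (-‿inverseˡ 1#)) (+-identityˡ _))) ⟩
    (- 1# + 1#) + m · 1# + - (n · 1#)        ≡⟨ cong (_+ - (n · 1#)) (trans (+-assoc _ _ _) (+-comm _ _)) ⟩
    (suc m · 1# + - 1#) + - (n · 1#)         ≡⟨ +-assoc _ _ _ ⟩
    suc m · 1# + (- 1# + - (n · 1#))         ≡⟨ cong ((suc m · 1#) +_) (-‿+-comm _ _) ⟩
    suc m · 1# + - (suc n · 1#)              ∎

  fromℤ-+ : ∀ i j → fromℤ (i ℤ.+ j) ≡ fromℤ i + fromℤ j
  fromℤ-+ (ℤ.+ m)    (ℤ.+ n)    = ×-homo-+ 1# m n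
  fromℤ-+ (ℤ.+ m)    -[1+ n ] = fromℤ-⊖ m (suc n)
  fromℤ-+ -[1+ m ] (ℤ.+ n)    = trans (fromℤ-⊖ n (suc m)) (+-comm _ _)
  fromℤ-+ -[1+ m ] -[1+ n ] = begin
    - (suc (suc (m ℕ.+ n)) · 1#)         ≡⟨ cong (λ k → - (suc k · 1#)) (sym (ℕ.+-suc m n)) ⟩
    - ((suc m ℕ.+ suc n) · 1#)           ≡⟨ cong -_ (×-homo-+ 1# (suc m) (suc n)) ⟩
    - (suc m · 1# + suc n · 1#)          ≡⟨ sym (-‿+-comm _ _) ⟩
    - (suc m · 1#) + - (suc n · 1#)      ∎

  fromℤ-* : ∀ i j → fromℤ (i ℤ.* j) ≡ fromℤ i * fromℤ j
  fromℤ-* i j = begin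
    fromℤ (i ℤ.* j)                                                     ≡⟨ fromℤ-◃ (ℤ.sign i Sign.* ℤ.sign j) (ℤ.∣ i ∣ ℕ.* ℤ.∣ j ∣) ⟩
    signed (ℤ.sign i Sign.* ℤ.sign j) ((ℤ.∣ i ∣ ℕ.* ℤ.∣ j ∣) · 1#)      ≡⟨ cong (signed (ℤ.sign i Sign.* ℤ.sign j)) (×1-homo-* ℤ.∣ i ∣ ℤ.∣ j ∣) ⟩
    signed (ℤ.sign i Sign.* ℤ.sign j) ((ℤ.∣ i ∣ · 1#) * (ℤ.∣ j ∣ · 1#)) ≡⟨ signed-* (ℤ.sign i) (ℤ.sign j) _ _ ⟩
    signed (ℤ.sign i) (ℤ.∣ i ∣ · 1#) * signed (ℤ.sign j) (ℤ.∣ j ∣ · 1#) ≡⟨ sym (cong₂ _*_ (signed-abs i) (signed-abs j)) ⟩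
    fromℤ i * fromℤ j                                                   ∎

  fromℤ-neg : ∀ i → fromℤ (ℤ.- i) ≡ - fromℤ i
  fromℤ-neg (ℤ.+ zero)    = sym -0#≈0#
  fromℤ-neg (ℤ.+ suc n)   = refl
  fromℤ-neg -[1+ n ]    = sym (-‿involutive _)

  -- ±1 go to 1# and - 1# (not 1# + 0#), and n · 1# computes to fromℕ n on
  -- literals, so solver constants match goals written with 1#, - 1#, fromℕ n.
  ⟦_⟧ℤ : ℤ → R
  ⟦ ℤ.+ 1 ⟧ℤ       = 1#
  ⟦ -[1+ 0 ] ⟧ℤ  = - 1#
  ⟦ i ⟧ℤ         = fromℤ i

  ⟦⟧ℤ≡fromℤ : ∀ i → ⟦ i ⟧ℤ ≡ fromℤ i
  ⟦⟧ℤ≡fromℤ (ℤ.+ 0)           = refl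
  ⟦⟧ℤ≡fromℤ (ℤ.+ 1)           = sym (+-identityʳ 1#)
  ⟦⟧ℤ≡fromℤ (ℤ.+ suc (suc n)) = refl
  ⟦⟧ℤ≡fromℤ -[1+ 0 ]        = cong -_ (sym (+-identityʳ 1#))
  ⟦⟧ℤ≡fromℤ -[1+ suc n ]    = refl

  ⟦⟧ℤ-homo₂ : ∀ {f : ℤ → ℤ → ℤ} {g : Op₂ R} → (∀ i j → fromℤ (f i j) ≡ g (fromℤ i) (fromℤ j)) →
              ∀ i j → ⟦ f i j ⟧ℤ ≡ g ⟦ i ⟧ℤ ⟦ j ⟧ℤ
  ⟦⟧ℤ-homo₂ {f} {g} homo i j =
    trans (⟦⟧ℤ≡fromℤ (f i j)) (trans (homo i j) (sym (cong₂ g (⟦⟧ℤ≡fromℤ i) (⟦⟧ℤ≡fromℤ j))))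

  morphism : ℤ.+-*-rawRing -Raw-AlmostCommutative⟶ fromCommutativeRing commutativeRing
  morphism = record
    { ⟦_⟧    = ⟦_⟧ℤ
    ; +-homo = ⟦⟧ℤ-homo₂ {ℤ._+_} {_+_} fromℤ-+
    ; *-homo = ⟦⟧ℤ-homo₂ {ℤ._*_} {_*_} fromℤ-*
    ; -‿homo = λ i → trans (⟦⟧ℤ≡fromℤ (ℤ.- i)) (trans (fromℤ-neg i) (sym (cong -_ (⟦⟧ℤ≡fromℤ i))))
    ; 0-homo = refl
    ; 1-homo = refl
    }

  ≟-maybe : ∀ i j → Maybe (⟦ i ⟧ℤ ≡ ⟦ j ⟧ℤ)
  ≟-maybe i j with i ℤ.≟ j
  ... | yes refl = just refl
  ... | no _     = nothing

  open Algebra.Solver.Ring ℤ.+-*-rawRing (fromCommutativeRing commutativeRing) morphism ≟-maybe public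

module FiniteFieldTheory {ℓ} (F : FiniteField ℓ) where
  open FiniteField F public
  open IsCommutativeRing isCommutativeRing using (+-isCommutativeMonoid; *-isCommutativeMonoid)
  open IntegerCoefficientSolver isCommutativeRing public using (solve; _:=_; _:+_; _:*_; :-_; con)
  open IntegerCoefficientSolver isCommutativeRing using (commutativeRing)
  open CommutativeRing commutativeRing public
    using (+-assoc; +-comm; +-identityˡ; +-identityʳ; *-assoc; *-comm; *-identityˡ; *-identityʳ;
           distribˡ; distribʳ; zeroˡ; zeroʳ; -‿inverseˡ; -‿inverseʳ)
  open RingProperties (CommutativeRing.ring commutativeRing) public
    using (-‿involutive; -0#≈0#; +-cancelˡ; +-cancelʳ; +-inverseˡ-unique)
  open ≡-Reasoning

  module Add = FiniteSum +-isCommutativeMonoid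
  module Mul = FiniteSum *-isCommutativeMonoid
  module Count = FiniteSum ℕ.+-0-isCommutativeMonoid
  module AddF = Add.OverFinite _≟_ elements unique complete
  module MulF = Mul.OverFinite _≟_ elements unique complete
  module CountF = Count.OverFinite _≟_ elements unique complete
  open Add public using (∑; when; when-yes; when-no; when-cong; when-⊎; ∑-cong; ∑-distrib; ∑-vanishing; ∑-comm; ∑-when-unique)
  open AddF public using (∑ₐ; ∑-when-≡; ∑-reindex)
  open Mul using () renaming (∑ to ∏)
  open MulF using () renaming (∑ₐ to ∏ₐ)

  x+-y≡0⇒x≡y : ∀ x y → x + - y ≡ 0# → x ≡ y
  x+-y≡0⇒x≡y x y eq = trans (+-inverseˡ-unique x (- y) eq) (-‿involutive y)

  1#≢0# : ¬ (1# ≡ 0#)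
  1#≢0# eq = 0≢1 (sym eq)

  inverseˡ : ∀ x → ¬ (x ≡ 0#) → x ⁻¹ * x ≡ 1#
  inverseˡ x x≢0 = trans (*-comm _ _) (inverseʳ x x≢0)

  *-cancelˡ : ∀ x {y z} → ¬ (x ≡ 0#) → x * y ≡ x * z → y ≡ z
  *-cancelˡ x {y} {z} x≢0 eq = begin
    y                ≡⟨ sym (*-identityˡ y) ⟩
    1# * y           ≡⟨ cong (_* y) (sym (inverseˡ x x≢0)) ⟩
    (x ⁻¹ * x) * y   ≡⟨ *-assoc _ _ _ ⟩
    x ⁻¹ * (x * y)   ≡⟨ cong (x ⁻¹ *_) eq ⟩
    x ⁻¹ * (x * z)   ≡⟨ sym (*-assoc _ _ _) ⟩
    (x ⁻¹ * x) * z   ≡⟨ cong (_* z) (inverseˡ x x≢0) ⟩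
    1# * z           ≡⟨ *-identityˡ z ⟩
    z                ∎

  *-cancelʳ : ∀ {x y} z → ¬ (z ≡ 0#) → x * z ≡ y * z → x ≡ y
  *-cancelʳ z z≢0 eq = *-cancelˡ z z≢0 (trans (*-comm _ _) (trans eq (*-comm _ _)))

  x⁻¹*[x*y]≡y : ∀ x → ¬ (x ≡ 0#) → ∀ y → x ⁻¹ * (x * y) ≡ y
  x⁻¹*[x*y]≡y x x≢0 y = trans (sym (*-assoc _ _ _)) (trans (cong (_* y) (inverseˡ x x≢0)) (*-identityˡ y))

  x*[x⁻¹*y]≡y : ∀ x → ¬ (x ≡ 0#) → ∀ y → x * (x ⁻¹ * y) ≡ y
  x*[x⁻¹*y]≡y x x≢0 y = trans (sym (*-assoc _ _ _)) (trans (cong (_* y) (inverseʳ x x≢0)) (*-identityˡ y))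

  x*y≡0⇒x≡0⊎y≡0 : ∀ x y → x * y ≡ 0# → x ≡ 0# ⊎ y ≡ 0#
  x*y≡0⇒x≡0⊎y≡0 x y eq with x ≟ 0#
  ... | yes x≡0 = inj₁ x≡0
  ... | no x≢0  = inj₂ (*-cancelˡ x x≢0 (trans eq (sym (zeroʳ x))))

  *-≢0 : ∀ {x y} → ¬ (x ≡ 0#) → ¬ (y ≡ 0#) → ¬ (x * y ≡ 0#)
  *-≢0 x≢0 y≢0 eq with x*y≡0⇒x≡0⊎y≡0 _ _ eq
  ... | inj₁ x≡0 = x≢0 x≡0
  ... | inj₂ y≡0 = y≢0 y≡0

  x*x≡0⇒x≡0 : ∀ x → x * x ≡ 0# → x ≡ 0#
  x*x≡0⇒x≡0 x eq with x*y≡0⇒x≡0⊎y≡0 x x eq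
  ... | inj₁ x≡0 = x≡0
  ... | inj₂ x≡0 = x≡0

  x*x≡y*y⇒x≡y⊎x≡-y : ∀ x y → x * x ≡ y * y → x ≡ y ⊎ x ≡ - y
  x*x≡y*y⇒x≡y⊎x≡-y x y eq with x*y≡0⇒x≡0⊎y≡0 (x + - y) (x + y) (begin
      (x + - y) * (x + y)  ≡⟨ solve 2 (λ x y → (x :+ :- y) :* (x :+ y) := x :* x :+ :- (y :* y)) refl x y ⟩
      x * x + - (y * y)    ≡⟨ cong (λ t → t + - (y * y)) eq ⟩
      y * y + - (y * y)    ≡⟨ -‿inverseʳ _ ⟩
      0#                   ∎)
  ... | inj₁ x-y≡0 = inj₁ (x+-y≡0⇒x≡y _ _ x-y≡0)
  ... | inj₂ x+y≡0 = inj₂ (+-inverseˡ-unique x y x+y≡0)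

  -x*-x≡x*x : ∀ x → - x * - x ≡ x * x
  -x*-x≡x*x x = solve 1 (λ x → :- x :* :- x := x :* x) refl x

  -x≡0⇒x≡0 : ∀ {x} → - x ≡ 0# → x ≡ 0#
  -x≡0⇒x≡0 {x} eq = trans (sym (-‿involutive x)) (trans (cong -_ eq) -0#≈0#)

  ∑-*ˡ : ∀ {b} {A : Set b} (xs : List A) (f : A → Carrier) c → ∑ xs (λ x → c * f x) ≡ c * ∑ xs f
  ∑-*ˡ []       f c = sym (zeroʳ c)
  ∑-*ˡ (x ∷ xs) f c = trans (cong (c * f x +_) (∑-*ˡ xs f c)) (sym (distribˡ _ _ _))

  ∑-neg : ∀ {b} {A : Set b} (xs : List A) (f : A → Carrier) → ∑ xs (λ x → - f x) ≡ - ∑ xs f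
  ∑-neg xs f = begin
    ∑ xs (λ x → - f x)       ≡⟨ ∑-cong xs (λ x → solve 1 (λ a → :- a := con ℤ.-1ℤ :* a) refl (f x)) ⟩
    ∑ xs (λ x → - 1# * f x)  ≡⟨ ∑-*ˡ xs f (- 1#) ⟩
    - 1# * ∑ xs f            ≡⟨ solve 1 (λ a → con ℤ.-1ℤ :* a := :- a) refl _ ⟩
    - ∑ xs f                 ∎

  ∑-const : ∀ {b} {A : Set b} (xs : List A) c → ∑ xs (λ _ → c) ≡ fromℕ (length xs) * c
  ∑-const []       c = sym (zeroˡ c)
  ∑-const (x ∷ xs) c = trans (cong₂ _+_ (sym (*-identityˡ c)) (∑-const xs c)) (sym (distribʳ _ _ _))

  -- Translating by 1 permutes the field, so ∑ (x + 1) = ∑ x forces q · 1 = 0.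
  fromℕ[size]≡0 : fromℕ size ≡ 0#
  fromℕ[size]≡0 = trans (sym (*-identityʳ _)) (+-cancelˡ (∑ₐ (λ x → x)) _ _ (begin
    ∑ₐ (λ x → x) + fromℕ size * 1#      ≡⟨ cong (∑ₐ (λ x → x) +_) (sym (∑-const elements 1#)) ⟩
    ∑ₐ (λ x → x) + ∑ₐ (λ _ → 1#)        ≡⟨ sym (∑-distrib elements (λ x → x) (λ _ → 1#)) ⟩
    ∑ₐ (λ x → x + 1#)                    ≡⟨ ∑-reindex (_+ 1#) (_+ - 1#) cancel₁ cancel₂ (λ x → x) ⟩
    ∑ₐ (λ x → x)                         ≡⟨ sym (+-identityʳ _) ⟩
    ∑ₐ (λ x → x) + 0#                    ∎))
    where
    cancel₁ : ∀ x → x + 1# + - 1# ≡ x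
    cancel₁ x = solve 1 (λ x → x :+ con ℤ.1ℤ :+ :- con ℤ.1ℤ := x) refl x
    cancel₂ : ∀ x → x + - 1# + 1# ≡ x
    cancel₂ x = solve 1 (λ x → x :+ :- con ℤ.1ℤ :+ con ℤ.1ℤ := x) refl x

  ∑ₐ-const : ∀ c → ∑ₐ (λ _ → c) ≡ 0#
  ∑ₐ-const c = trans (∑-const elements c) (trans (cong (_* c) fromℕ[size]≡0) (zeroˡ c))

  ^-distribˡ-+-* : ∀ x m n → x ^ (m ℕ.+ n) ≡ x ^ m * x ^ n
  ^-distribˡ-+-* x zero    n = sym (*-identityˡ _)
  ^-distribˡ-+-* x (suc m) n = trans (cong (x *_) (^-distribˡ-+-* x m n)) (sym (*-assoc _ _ _))

  ^-distribʳ-* : ∀ x y n → (x * y) ^ n ≡ x ^ n * y ^ n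
  ^-distribʳ-* x y zero    = sym (*-identityˡ 1#)
  ^-distribʳ-* x y (suc n) = trans (cong ((x * y) *_) (^-distribʳ-* x y n))
                                   (solve 4 (λ x y u v → (x :* y) :* (u :* v) := (x :* u) :* (y :* v)) refl x y (x ^ n) (y ^ n))

  size≡1+[size∸1] : size ≡ suc (size ℕ.∸ 1)
  size≡1+[size∸1] with elements | complete 0#
  ... | _ ∷ _ | _ = refl

  unit : Carrier → Carrier
  unit y with y ≟ 0#
  ... | yes _ = 1#
  ... | no _  = y

  unit-≢0 : ∀ y → ¬ (unit y ≡ 0#)
  unit-≢0 y with y ≟ 0#
  ... | yes _   = 1#≢0#
  ... | no y≢0  = y≢0

  unit-* : ∀ x → ¬ (x ≡ 0#) → ∀ y → unit (x * y) ≡ Mul.when (¬? (y ≟ 0#)) x * unit y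
  unit-* x x≢0 y with y ≟ 0# | (x * y) ≟ 0#
  ... | yes _    | yes _      = sym (*-identityˡ 1#)
  ... | yes y≡0  | no xy≢0    = ⊥-elim (xy≢0 (trans (cong (x *_) y≡0) (zeroʳ x)))
  ... | no y≢0   | yes xy≡0   = ⊥-elim (*-≢0 x≢0 y≢0 xy≡0)
  ... | no _     | no _       = refl

  ∏-≢0 : ∀ {b} {A : Set b} (xs : List A) f → (∀ x → ¬ (f x ≡ 0#)) → ¬ (∏ xs f ≡ 0#)
  ∏-≢0 []       f f≢0 = 1#≢0#
  ∏-≢0 (x ∷ xs) f f≢0 = *-≢0 (f≢0 x) (∏-≢0 xs f f≢0)

  ∏-const : ∀ {b} {A : Set b} (xs : List A) x → ∏ xs (λ _ → x) ≡ x ^ length xs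
  ∏-const []       x = refl
  ∏-const (y ∷ xs) x = cong (x *_) (∏-const xs x)

  -- Multiplying by x permutes the field, so ∏ unit (x y) = ∏ unit y; the left
  -- side is x^(q-1) ∏ unit y, and adjoining the factor at y = 0 gives x^q = x.
  fermat-little : ∀ x → ¬ (x ≡ 0#) → x ^ (size ℕ.∸ 1) ≡ 1#
  fermat-little x x≢0 = *-cancelˡ x x≢0 (begin
    x * x ^ (size ℕ.∸ 1)     ≡⟨ cong (x ^_) (sym size≡1+[size∸1]) ⟩
    x ^ size                 ≡⟨ sym (∏-const elements x) ⟩
    ∏ₐ (λ _ → x)        ≡⟨ Mul.∑-cong elements (λ y → sym (split y)) ⟩
    ∏ₐ (λ y → Mul.when (¬? (y ≟ 0#)) x * Mul.when (y ≟ 0#) x) ≡⟨ Mul.∑-distrib elements _ _ ⟩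
    H * ∏ₐ (λ y → Mul.when (y ≟ 0#) x)  ≡⟨ cong₂ _*_ H≡1 (MulF.∑-when-≡ 0# (λ _ → x)) ⟩
    1# * x                   ≡⟨ *-identityˡ x ⟩
    x                        ≡⟨ sym (*-identityʳ x) ⟩
    x * 1#                   ∎)
    where
    split : ∀ y → Mul.when (¬? (y ≟ 0#)) x * Mul.when (y ≟ 0#) x ≡ x
    split y with y ≟ 0#
    ... | yes _ = *-identityˡ x
    ... | no _  = *-identityʳ x
    H : Carrier
    H = ∏ₐ (λ y → Mul.when (¬? (y ≟ 0#)) x)
    H≡1 : H ≡ 1#
    H≡1 = *-cancelʳ (∏ₐ unit) (∏-≢0 elements unit unit-≢0) (begin
      H * ∏ₐ unit                            ≡⟨ sym (Mul.∑-distrib elements _ unit) ⟩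
      ∏ₐ (λ y → Mul.when (¬? (y ≟ 0#)) x * unit y) ≡⟨ Mul.∑-cong elements (λ y → sym (unit-* x x≢0 y)) ⟩
      ∏ₐ (λ y → unit (x * y))                 ≡⟨ MulF.∑-reindex (x *_) (x ⁻¹ *_) (x⁻¹*[x*y]≡y x x≢0) (x*[x⁻¹*y]≡y x x≢0) unit ⟩
      ∏ₐ unit                                 ≡⟨ sym (*-identityˡ _) ⟩
      1# * ∏ₐ unit                            ∎)

  data Degree≤ : ℕ → (Carrier → Carrier) → Set ℓ where
    const  : ∀ {f} c → (∀ x → f x ≡ c) → Degree≤ 0 f
    horner : ∀ {d f} g c → Degree≤ d g → (∀ x → f x ≡ c + x * g x) → Degree≤ (suc d) f

  divide-by-root : ∀ {d f} → Degree≤ (suc d) f → (r : Carrier) →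
                   Σ[ g ∈ (Carrier → Carrier) ] (Degree≤ d g × (∀ x → f x ≡ (x + - r) * g x + f r))
  divide-by-root {f = f} (horner g c (const c′ g≗c′) f≗) r = (λ _ → c′) , const c′ (λ _ → refl) , λ x → begin
    f x                              ≡⟨ f≗ x ⟩
    c + x * g x                      ≡⟨ cong (λ t → c + x * t) (g≗c′ x) ⟩
    c + x * c′                       ≡⟨ solve 4 (λ c x c′ r → c :+ x :* c′ := (x :+ :- r) :* c′ :+ (c :+ r :* c′)) refl c x c′ r ⟩
    (x + - r) * c′ + (c + r * c′)    ≡⟨ cong (λ t → (x + - r) * c′ + (c + r * t)) (sym (g≗c′ r)) ⟩
    (x + - r) * c′ + (c + r * g r)   ≡⟨ cong ((x + - r) * c′ +_) (sym (f≗ r)) ⟩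
    (x + - r) * c′ + f r             ∎
  divide-by-root {f = f} (horner g c g≤@(horner _ _ _ _) f≗) r with divide-by-root g≤ r
  ... | k , k≤ , g≗ = (λ x → g r + x * k x) , horner k (g r) k≤ (λ x → refl) , λ x → begin
    f x
      ≡⟨ f≗ x ⟩
    c + x * g x
      ≡⟨ cong (λ t → c + x * t) (g≗ x) ⟩
    c + x * ((x + - r) * k x + g r)
      ≡⟨ solve 5 (λ c x r k g → c :+ x :* ((x :+ :- r) :* k :+ g) := (x :+ :- r) :* (g :+ x :* k) :+ (c :+ r :* g)) refl c x r (k x) (g r) ⟩
    (x + - r) * (g r + x * k x) + (c + r * g r)
      ≡⟨ cong ((x + - r) * (g r + x * k x) +_) (sym (f≗ r)) ⟩
    (x + - r) * (g r + x * k x) + f r ∎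

  roots>degree⇒≡0 : ∀ {d f} → Degree≤ d f → (rs : List Carrier) → Unique rs →
                    All (λ r → f r ≡ 0#) rs → d ℕ.< length rs → ∀ x → f x ≡ 0#
  roots>degree⇒≡0 (const c f≗c) (r ∷ rs) _ (fr≡0 ∷ _) _ x = trans (f≗c x) (trans (sym (f≗c r)) fr≡0)
  roots>degree⇒≡0 {f = f} f≤@(horner _ _ _ _) (r ∷ rs) (r∉rs ∷ rs!) (fr≡0 ∷ frs≡0) (s≤s d<) x
    with divide-by-root f≤ r
  ... | g , g≤ , f≗ = begin
    f x                     ≡⟨ f≗ x ⟩
    (x + - r) * g x + f r   ≡⟨ cong₂ _+_ (cong ((x + - r) *_) (roots>degree⇒≡0 g≤ rs rs! grs≡0 d< x)) fr≡0 ⟩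
    (x + - r) * 0# + 0#     ≡⟨ trans (+-identityʳ _) (zeroʳ _) ⟩
    0#                      ∎
    where
    g≡0 : ∀ y → ¬ (r ≡ y) → f y ≡ 0# → g y ≡ 0#
    g≡0 y r≢y fy≡0 with x*y≡0⇒x≡0⊎y≡0 (y + - r) (g y)
                          (trans (sym (+-identityʳ _)) (trans (cong ((y + - r) * g y +_) (sym fr≡0)) (trans (sym (f≗ y)) fy≡0)))
    ... | inj₁ y-r≡0 = ⊥-elim (r≢y (sym (x+-y≡0⇒x≡y y r y-r≡0)))
    ... | inj₂ gy≡0  = gy≡0
    grs≡0 : All (λ y → g y ≡ 0#) rs
    grs≡0 = All.zipWith (λ (r≢y , fy≡0) → g≡0 _ r≢y fy≡0) (r∉rs , frs≡0)

  x^m-1-degree : ∀ m → Degree≤ m (λ x → x ^ m + - 1#)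
  x^m-1-degree zero    = const 0# (λ _ → -‿inverseʳ 1#)
  x^m-1-degree (suc m) = horner (λ x → x ^ m) (- 1#) (x^m-degree m) (λ x → +-comm _ _)
    where
    x^m-degree : ∀ m → Degree≤ m (λ x → x ^ m)
    x^m-degree zero    = const 1# (λ _ → refl)
    x^m-degree (suc m) = horner (λ x → x ^ m) 0# (x^m-degree m) (λ x → sym (+-identityˡ _))

  roots-of-unity≤m : ∀ m → 1 ℕ.≤ m → (rs : List Carrier) → Unique rs →
                     All (λ r → r ^ m ≡ 1#) rs → ¬ (m ℕ.< length rs)
  roots-of-unity≤m (suc m) _ rs rs! rs^m≡1 m<|rs| = 1#≢0# (-x≡0⇒x≡0 (begin
    - 1#                   ≡⟨ sym (trans (cong (_+ - 1#) (zeroˡ _)) (+-identityˡ _)) ⟩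
    0# ^ suc m + - 1#      ≡⟨ roots>degree⇒≡0 (x^m-1-degree (suc m)) rs rs! (All.map root rs^m≡1) m<|rs| 0# ⟩
    0#                     ∎))
    where
    root : ∀ {r} → r ^ suc m ≡ 1# → r ^ suc m + - 1# ≡ 0#
    root r^m≡1 = trans (cong (_+ - 1#) r^m≡1) (-‿inverseʳ 1#)

  length-filter : ∀ {p} {P : Carrier → Set p} (P? : Decidable P) (xs : List Carrier) →
                  length (filter P? xs) ≡ Count.∑ xs (λ x → Count.when (P? x) 1)
  length-filter P? []       = refl
  length-filter P? (x ∷ xs) with P? x
  ... | yes _ = cong suc (length-filter P? xs)
  ... | no _  = length-filter P? xs

  length≡∑1 : ∀ (xs : List Carrier) → length xs ≡ Count.∑ xs (λ _ → 1)
  length≡∑1 []       = refl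
  length≡∑1 (x ∷ xs) = cong suc (length≡∑1 xs)

  nonzero : List Carrier
  nonzero = filter (λ x → ¬? (x ≟ 0#)) elements

  nonzero-unique : Unique nonzero
  nonzero-unique = Unique.filter⁺ (λ x → ¬? (x ≟ 0#)) unique

  1+|nonzero|≡size : suc (length nonzero) ≡ size
  1+|nonzero|≡size = sym (begin
    size
      ≡⟨ length≡∑1 elements ⟩
    CountF.∑ₐ (λ _ → 1)
      ≡⟨ Count.∑-cong elements split ⟩
    CountF.∑ₐ (λ x → Count.when (x ≟ 0#) 1 ℕ.+ Count.when (¬? (x ≟ 0#)) 1)
      ≡⟨ Count.∑-distrib elements _ _ ⟩
    CountF.∑ₐ (λ x → Count.when (x ≟ 0#) 1) ℕ.+ CountF.∑ₐ (λ x → Count.when (¬? (x ≟ 0#)) 1)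
      ≡⟨ cong₂ ℕ._+_ (CountF.∑-when-≡ 0# (λ _ → 1)) (sym (length-filter _ elements)) ⟩
    suc (length nonzero) ∎)
    where
    split : ∀ x → 1 ≡ Count.when (x ≟ 0#) 1 ℕ.+ Count.when (¬? (x ≟ 0#)) 1
    split x with x ≟ 0#
    ... | yes _ = refl
    ... | no _  = refl

  ∃-non-root-of-unity : ∀ m → 1 ℕ.≤ m → 2 ℕ.+ m ℕ.≤ size → ∃ λ g → ¬ (g ≡ 0#) × ¬ (g ^ m ≡ 1#)
  ∃-non-root-of-unity m 1≤m m+2≤size with all? (λ y → (y ^ m) ≟ 1#) nonzero
  ... | yes all-roots =
    ⊥-elim (roots-of-unity≤m m 1≤m nonzero nonzero-unique all-roots
             (ℕ.s≤s⁻¹ (subst (2 ℕ.+ m ℕ.≤_) (sym 1+|nonzero|≡size) m+2≤size)))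
  ... | no ¬all-roots with find (¬All⇒Any¬ (λ y → (y ^ m) ≟ 1#) nonzero ¬all-roots)
  ...   | g , g∈ , g^m≢1 = g , proj₂ (∈-filter⁻ (λ x → ¬? (x ≟ 0#)) {xs = elements} g∈) , g^m≢1

  x≡c*x⇒x≡0 : ∀ {c x} → ¬ (c ≡ 1#) → x ≡ c * x → x ≡ 0#
  x≡c*x⇒x≡0 {c} {x} c≢1 x≡cx with x*y≡0⇒x≡0⊎y≡0 (c + - 1#) x (begin
      (c + - 1#) * x   ≡⟨ solve 2 (λ c x → (c :+ :- con ℤ.1ℤ) :* x := c :* x :+ :- x) refl c x ⟩
      c * x + - x      ≡⟨ cong (_+ - x) (sym x≡cx) ⟩
      x + - x          ≡⟨ -‿inverseʳ x ⟩
      0#               ∎)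
  ... | inj₁ c-1≡0 = ⊥-elim (c≢1 (x+-y≡0⇒x≡y _ _ c-1≡0))
  ... | inj₂ x≡0   = x≡0

  ∑-x^m-rescale : ∀ g → ¬ (g ≡ 0#) → ∀ m → ∑ₐ (λ x → x ^ m) ≡ g ^ m * ∑ₐ (λ x → x ^ m)
  ∑-x^m-rescale g g≢0 m = begin
    ∑ₐ (λ x → x ^ m)           ≡⟨ sym (∑-reindex (g *_) (g ⁻¹ *_) (x⁻¹*[x*y]≡y g g≢0) (x*[x⁻¹*y]≡y g g≢0) (λ x → x ^ m)) ⟩
    ∑ₐ (λ x → (g * x) ^ m)     ≡⟨ ∑-cong elements (λ x → ^-distribʳ-* g x m) ⟩
    ∑ₐ (λ x → g ^ m * x ^ m)   ≡⟨ ∑-*ˡ elements (λ x → x ^ m) (g ^ m) ⟩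
    g ^ m * ∑ₐ (λ x → x ^ m)   ∎

  ∑-x^m≡0 : ∀ m → 1 ℕ.≤ m → 2 ℕ.+ m ℕ.≤ size → ∑ₐ (λ x → x ^ m) ≡ 0#
  ∑-x^m≡0 m 1≤m m+2≤size with ∃-non-root-of-unity m 1≤m m+2≤size
  ... | g , g≢0 , g^m≢1 = x≡c*x⇒x≡0 g^m≢1 (∑-x^m-rescale g g≢0 m)

  any⇒∃ : ∀ {p} {P : Carrier → Set p} → Any.Any P elements → ∃ P
  any⇒∃ P∈ = let (x , _ , Px) = find P∈ in x , Px

  ∃⇒any : ∀ {p} {P : Carrier → Set p} → ∃ P → Any.Any P elements
  ∃⇒any (x , Px) = Any.map (λ { refl → Px }) (complete x)

  ∃? : ∀ {p} {P : Carrier → Set p} → Decidable P → Dec (∃ P)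
  ∃? P? = map′ any⇒∃ ∃⇒any (any? P? elements)

  when-∪ : ∀ {p q r} {P : Set p} {Q : Set q} {R : Set r} (P? : Dec P) (Q? : Dec Q) (R? : Dec R) →
           (P → Q ⊎ R) → (Q ⊎ R → P) → ∀ m →
           when P? m ≡ m * (when Q? 1# + when R? 1# + - (when Q? 1# * when R? 1#))
  when-∪ P? (yes q) (yes _) _ Q∪R→P m = trans (when-yes P? (Q∪R→P (inj₁ q)) m)
    (solve 1 (λ m → m := m :* (con ℤ.1ℤ :+ con ℤ.1ℤ :+ :- (con ℤ.1ℤ :* con ℤ.1ℤ))) refl m)
  when-∪ P? (yes q) (no _)  _ Q∪R→P m = trans (when-yes P? (Q∪R→P (inj₁ q)) m)
    (solve 1 (λ m → m := m :* (con ℤ.1ℤ :+ con ℤ.0ℤ :+ :- (con ℤ.1ℤ :* con ℤ.0ℤ))) refl m)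
  when-∪ P? (no _)  (yes r) _ Q∪R→P m = trans (when-yes P? (Q∪R→P (inj₂ r)) m)
    (solve 1 (λ m → m := m :* (con ℤ.0ℤ :+ con ℤ.1ℤ :+ :- (con ℤ.0ℤ :* con ℤ.1ℤ))) refl m)
  when-∪ P? (no ¬q) (no ¬r) P→Q∪R _ m = trans (when-no P? (λ p → [ ¬q , ¬r ]′ (P→Q∪R p)) m)
    (solve 1 (λ m → con ℤ.0ℤ := m :* (con ℤ.0ℤ :+ con ℤ.0ℤ :+ :- (con ℤ.0ℤ :* con ℤ.0ℤ))) refl m)

  sumList-filter : ∀ {p} {P : Carrier → Set p} (P? : Decidable P) (xs : List Carrier) →
                   sumList (filter P? xs) ≡ ∑ xs (λ y → when (P? y) y)
  sumList-filter P? []       = refl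
  sumList-filter P? (x ∷ xs) with P? x
  ... | yes _ = cong (x +_) (sumList-filter P? xs)
  ... | no _  = trans (sumList-filter P? xs) (sym (+-identityˡ _))

  S≡∑-values : ∀ f → S f ≡ ∑ₐ (λ y → when (∃? (λ x → f x ≟ y)) y)
  S≡∑-values f = trans (sumList-filter _ elements)
    (∑-cong elements (λ y → when-cong (any? (λ x → f x ≟ y) elements) (∃? (λ x → f x ≟ y)) any⇒∃ ∃⇒any y))

  x*y≡1⇒y≡x⁻¹ : ∀ x y → ¬ (x ≡ 0#) → x * y ≡ 1# → y ≡ x ⁻¹
  x*y≡1⇒y≡x⁻¹ x y x≢0 xy≡1 = trans (sym (x⁻¹*[x*y]≡y x x≢0 y)) (trans (cong (x ⁻¹ *_) xy≡1) (*-identityʳ _))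

module OddOrder {ℓ} (F : FiniteField ℓ) (size-odd : FiniteField.size F % 2 ≡ 1) where
  open FiniteFieldTheory F public
  open ≡-Reasoning

  half : ℕ
  half = (size ℕ.∸ 1) / 2

  size∸1≡half+half : size ℕ.∸ 1 ≡ half ℕ.+ half
  size∸1≡half+half = trans size∸1≡[size/2]*2 (trans (ℕ.*-comm (size / 2) 2)
                       (cong₂ ℕ._+_ size/2≡half (trans (ℕ.+-identityʳ _) size/2≡half)))
    where
    size∸1≡[size/2]*2 : size ℕ.∸ 1 ≡ size / 2 ℕ.* 2
    size∸1≡[size/2]*2 = cong (ℕ._∸ 1) (trans (m≡m%n+[m/n]*n size 2) (cong (ℕ._+ size / 2 ℕ.* 2) size-odd))
    size/2≡half : size / 2 ≡ half
    size/2≡half = sym (trans (cong (_/ 2) size∸1≡[size/2]*2) (m*n/n≡m (size / 2) 2))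

  size≡1+half+half : size ≡ suc (half ℕ.+ half)
  size≡1+half+half = trans size≡1+[size∸1] (cong suc size∸1≡half+half)

  1≤half : 1 ℕ.≤ half
  1≤half = positive half (subst (1 ℕ.≤_) size∸1≡half+half 1≤size∸1)
    where
    positive : ∀ n → 1 ℕ.≤ n ℕ.+ n → 1 ℕ.≤ n
    positive (suc n) _ = s≤s z≤n
    1∈nonzero : 1# ∈ nonzero
    1∈nonzero = ∈-filter⁺ (λ x → ¬? (x ≟ 0#)) (complete 1#) 1#≢0#
    nonempty : ∀ {x} {xs : List Carrier} → x ∈ xs → 1 ℕ.≤ length xs
    nonempty (here _)  = s≤s z≤n
    nonempty (there _) = s≤s z≤n
    1≤size∸1 : 1 ℕ.≤ size ℕ.∸ 1
    1≤size∸1 = subst (λ n → 1 ℕ.≤ n ℕ.∸ 1) 1+|nonzero|≡size (nonempty 1∈nonzero)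

  fromℕ-+ : ∀ m n → fromℕ (m ℕ.+ n) ≡ fromℕ m + fromℕ n
  fromℕ-+ zero    n = sym (+-identityˡ _)
  fromℕ-+ (suc m) n = trans (cong (1# +_) (fromℕ-+ m n)) (sym (+-assoc _ _ _))

  -- q = 1 + 2·half vanishes in the field, so 2 = 0 would force 1 = 0.
  2≢0 : ¬ (fromℕ 2 ≡ 0#)
  2≢0 2≡0 = 1#≢0# (begin
    1#                                 ≡⟨ sym (+-identityʳ 1#) ⟩
    1# + 0#                            ≡⟨ cong (1# +_) (sym (zeroˡ (fromℕ half))) ⟩
    1# + 0# * fromℕ half               ≡⟨ cong (λ t → 1# + t * fromℕ half) (sym 2≡0) ⟩
    1# + fromℕ 2 * fromℕ half          ≡⟨ cong (1# +_) (solve 1 (λ n → con (ℤ.+ 2) :* n := n :+ n) refl (fromℕ half)) ⟩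
    1# + (fromℕ half + fromℕ half)     ≡⟨ cong (1# +_) (sym (fromℕ-+ half half)) ⟩
    fromℕ (suc (half ℕ.+ half))        ≡⟨ cong fromℕ (sym size≡1+half+half) ⟩
    fromℕ size                         ≡⟨ fromℕ[size]≡0 ⟩
    0#                                 ∎)

  8≢0 : ¬ (fromℕ 8 ≡ 0#)
  8≢0 8≡0 = *-≢0 2≢0 (*-≢0 2≢0 2≢0)
    (trans (solve 0 (con (ℤ.+ 2) :* (con (ℤ.+ 2) :* con (ℤ.+ 2)) := con (ℤ.+ 8)) refl) 8≡0)

  64≢0 : ¬ (fromℕ 64 ≡ 0#)
  64≢0 64≡0 = *-≢0 8≢0 8≢0 (trans (solve 0 (con (ℤ.+ 8) :* con (ℤ.+ 8) := con (ℤ.+ 64)) refl) 64≡0)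

  x≢-x : ∀ x → ¬ (x ≡ 0#) → ¬ (x ≡ - x)
  x≢-x x x≢0 x≡-x = *-≢0 2≢0 x≢0 (begin
    fromℕ 2 * x  ≡⟨ solve 1 (λ x → con (ℤ.+ 2) :* x := x :+ x) refl x ⟩
    x + x        ≡⟨ cong (x +_) x≡-x ⟩
    x + - x      ≡⟨ -‿inverseʳ x ⟩
    0#           ∎)

  χ*χ≡1 : ∀ x → ¬ (x ≡ 0#) → χ x * χ x ≡ 1#
  χ*χ≡1 x x≢0 = trans (sym (^-distribˡ-+-* x half half))
                      (trans (cong (x ^_) (sym size∸1≡half+half)) (fermat-little x x≢0))

  χ≡1⊎χ≡-1 : ∀ x → ¬ (x ≡ 0#) → χ x ≡ 1# ⊎ χ x ≡ - 1#
  χ≡1⊎χ≡-1 x x≢0 = x*x≡y*y⇒x≡y⊎x≡-y (χ x) 1# (trans (χ*χ≡1 x x≢0) (sym (*-identityˡ 1#)))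

  χ0≡0 : χ 0# ≡ 0#
  χ0≡0 = 0^n≡0 half 1≤half
    where
    0^n≡0 : ∀ n → 1 ℕ.≤ n → 0# ^ n ≡ 0#
    0^n≡0 (suc n) _ = zeroˡ _

  χ-* : ∀ x y → χ (x * y) ≡ χ x * χ y
  χ-* x y = ^-distribʳ-* x y half

  χ[x*x]≡1 : ∀ x → ¬ (x ≡ 0#) → χ (x * x) ≡ 1#
  χ[x*x]≡1 x x≢0 = trans (χ-* x x) (χ*χ≡1 x x≢0)

  IsSquare : Carrier → Set ℓ
  IsSquare z = ∃ λ u → u * u ≡ z

  isSquare? : Decidable IsSquare
  isSquare? z = ∃? (λ u → (u * u) ≟ z)

  square-roots : ∀ {z u₀} → u₀ * u₀ ≡ z → ∀ u → z ≡ u * u → u ≡ u₀ ⊎ u ≡ - u₀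
  square-roots u₀² u z≡u² = x*x≡y*y⇒x≡y⊎x≡-y _ _ (trans (sym z≡u²) (sym u₀²))

  root-≢0 : ∀ {z u₀} → ¬ (z ≡ 0#) → u₀ * u₀ ≡ z → ¬ (u₀ ≡ 0#)
  root-≢0 z≢0 u₀² u₀≡0 = z≢0 (trans (sym u₀²) (trans (cong (λ t → t * t) u₀≡0) (zeroˡ 0#)))

  χ[square]≡1 : ∀ z → ¬ (z ≡ 0#) → IsSquare z → χ z ≡ 1#
  χ[square]≡1 z z≢0 (u , u²) = trans (cong χ (sym u²)) (χ[x*x]≡1 u (root-≢0 z≢0 u²))

  IsNonzeroSquare : Carrier → Set ℓ
  IsNonzeroSquare z = ¬ (z ≡ 0#) × IsSquare z

  nonzeroSquare? : Decidable IsNonzeroSquare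
  nonzeroSquare? z = ¬? (z ≟ 0#) ×-dec isSquare? z

  nonzeroSquares : List Carrier
  nonzeroSquares = filter nonzeroSquare? elements

  NonzeroRoot : Carrier → Carrier → Set ℓ
  NonzeroRoot z u = z ≡ u * u × ¬ (u ≡ 0#)

  nonzeroRoot? : ∀ z u → Dec (NonzeroRoot z u)
  nonzeroRoot? z u = (z ≟ (u * u)) ×-dec ¬? (u ≟ 0#)

  #squares-of-nonzero : ∀ u → CountF.∑ₐ (λ z → Count.when (nonzeroRoot? z u) 1) ≡ Count.when (¬? (u ≟ 0#)) 1
  #squares-of-nonzero u = by-cases (u ≟ 0#)
    where
    by-cases : Dec (u ≡ 0#) → CountF.∑ₐ (λ z → Count.when (nonzeroRoot? z u) 1) ≡ Count.when (¬? (u ≟ 0#)) 1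
    by-cases (yes u≡0) =
      trans (Count.∑-vanishing elements _ (λ z _ → Count.when-no (nonzeroRoot? z u) (λ (_ , u≢0) → u≢0 u≡0) 1))
            (sym (Count.when-no (¬? (u ≟ 0#)) (λ u≢0 → u≢0 u≡0) 1))
    by-cases (no u≢0) =
      trans (Count.∑-when-unique (λ z → nonzeroRoot? z u) elements unique (u * u) (complete _) (refl , u≢0)
                                 (λ z (z≡u² , _) → z≡u²) (λ _ → 1))
            (sym (Count.when-yes (¬? (u ≟ 0#)) u≢0 1))

  #nonzero-roots : ∀ z → CountF.∑ₐ (λ u → Count.when (nonzeroRoot? z u) 1)
                         ≡ Count.when (nonzeroSquare? z) 1 ℕ.+ Count.when (nonzeroSquare? z) 1
  #nonzero-roots z with nonzeroSquare? z
  ... | no ¬□ = Count.∑-vanishing elements _ (λ u _ → Count.when-no (nonzeroRoot? z u)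
                  (λ (z≡u² , u≢0) → ¬□ ((λ z≡0 → u≢0 (x*x≡0⇒x≡0 u (trans (sym z≡u²) z≡0))) , u , sym z≡u²)) 1)
  ... | yes (z≢0 , u₀ , u₀²) = CountF.∑-when-pair (nonzeroRoot? z) u₀ (- u₀) (x≢-x u₀ u₀≢0)
        (sym u₀² , u₀≢0) (trans (sym u₀²) (sym (-x*-x≡x*x u₀)) , λ -u₀≡0 → u₀≢0 (-x≡0⇒x≡0 -u₀≡0))
        (λ u (z≡u² , _) → square-roots u₀² u z≡u²) 1
    where
    u₀≢0 : ¬ (u₀ ≡ 0#)
    u₀≢0 = root-≢0 z≢0 u₀²

  -- Double counting of the pairs (z , u) with z = u² and u ≠ 0.
  |nonzeroSquares|≡half : length nonzeroSquares ≡ half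
  |nonzeroSquares|≡half = sym (double-injective (begin
    half ℕ.+ half
      ≡⟨ sym size∸1≡half+half ⟩
    size ℕ.∸ 1
      ≡⟨ cong (ℕ._∸ 1) (sym 1+|nonzero|≡size) ⟩
    length nonzero
      ≡⟨ length-filter _ elements ⟩
    CountF.∑ₐ (λ u → Count.when (¬? (u ≟ 0#)) 1)
      ≡⟨ Count.∑-cong elements (λ u → sym (#squares-of-nonzero u)) ⟩
    CountF.∑ₐ (λ u → CountF.∑ₐ (λ z → Count.when (nonzeroRoot? z u) 1))
      ≡⟨ Count.∑-comm elements elements _ ⟩
    CountF.∑ₐ (λ z → CountF.∑ₐ (λ u → Count.when (nonzeroRoot? z u) 1))
      ≡⟨ Count.∑-cong elements #nonzero-roots ⟩
    CountF.∑ₐ (λ z → Count.when (nonzeroSquare? z) 1 ℕ.+ Count.when (nonzeroSquare? z) 1)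
      ≡⟨ Count.∑-distrib elements _ _ ⟩
    CountF.∑ₐ (λ z → Count.when (nonzeroSquare? z) 1) ℕ.+ CountF.∑ₐ (λ z → Count.when (nonzeroSquare? z) 1)
      ≡⟨ sym (cong₂ ℕ._+_ (length-filter _ elements) (length-filter _ elements)) ⟩
    length nonzeroSquares ℕ.+ length nonzeroSquares                    ∎))
    where
    double-injective : ∀ {m n} → m ℕ.+ m ≡ n ℕ.+ n → m ≡ n
    double-injective {m} {n} eq = ℕ.*-cancelˡ-≡ m n 2
      (trans (cong (m ℕ.+_) (ℕ.+-identityʳ m)) (trans eq (sym (cong (n ℕ.+_) (ℕ.+-identityʳ n)))))

  -- A nonsquare z with χ z = 1 would be a further root of x^half = 1,
  -- beyond the half nonzero squares.
  euler-criterion : ∀ z → ¬ (z ≡ 0#) → χ z ≡ 1# → IsSquare z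
  euler-criterion z z≢0 χz≡1 with isSquare? z
  ... | yes □ = □
  ... | no ¬□ = ⊥-elim (roots-of-unity≤m half 1≤half (z ∷ nonzeroSquares)
                  (z∉ ∷ Unique.filter⁺ _ unique) (χz≡1 ∷ squares-are-roots)
                  (subst (half ℕ.<_) (cong suc (sym |nonzeroSquares|≡half)) ℕ.≤-refl))
    where
    member : ∀ {w} → w ∈ nonzeroSquares → IsNonzeroSquare w
    member w∈ = proj₂ (∈-filter⁻ nonzeroSquare? {xs = elements} w∈)
    z∉ : All (λ w → ¬ (z ≡ w)) nonzeroSquares
    z∉ = All.tabulate (λ w∈ z≡w → ¬□ (subst IsSquare (sym z≡w) (proj₂ (member w∈))))
    squares-are-roots : All (λ w → w ^ half ≡ 1#) nonzeroSquares
    squares-are-roots = All.tabulate (λ {w} w∈ → χ[square]≡1 w (proj₁ (member w∈)) (proj₂ (member w∈)))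

  χ[nonsquare]≡-1 : ∀ z → ¬ (z ≡ 0#) → ¬ IsSquare z → χ z ≡ - 1#
  χ[nonsquare]≡-1 z z≢0 ¬□ with χ≡1⊎χ≡-1 z z≢0
  ... | inj₁ χz≡1  = ⊥-elim (¬□ (euler-criterion z z≢0 χz≡1))
  ... | inj₂ χz≡-1 = χz≡-1

  δ : Carrier → Carrier
  δ t = when (t ≟ 0#) 1#

  when≡*when1 : ∀ {p} {P : Set p} (P? : Dec P) m → when P? m ≡ m * when P? 1#
  when≡*when1 (yes _) m = sym (*-identityʳ m)
  when≡*when1 (no _)  m = sym (zeroʳ m)

  ∑-*δ : ∀ (G φ : Carrier → Carrier) v → φ v ≡ 0# → (∀ u → φ u ≡ 0# → u ≡ v) →
         ∑ₐ (λ u → G u * δ (φ u)) ≡ G v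
  ∑-*δ G φ v φv≡0 φu≡0⇒u≡v = trans (∑-cong elements (λ u → sym (when≡*when1 (φ u ≟ 0#) (G u))))
                                   (∑-when-unique (λ u → φ u ≟ 0#) elements unique v (complete v) φv≡0 φu≡0⇒u≡v G)

  #square-roots≡1+χ : ∀ z → ∑ₐ (λ u → when (z ≟ (u * u)) 1#) ≡ 1# + χ z
  #square-roots≡1+χ z with z ≟ 0# | isSquare? z
  ... | yes refl | _ = begin
    ∑ₐ (λ u → when (0# ≟ (u * u)) 1#)   ≡⟨ ∑-cong elements (λ u → when-cong (0# ≟ (u * u)) (u ≟ 0#)
                                              (λ 0≡u² → x*x≡0⇒x≡0 u (sym 0≡u²)) (λ { refl → sym (zeroˡ 0#) }) 1#) ⟩
    ∑ₐ (λ u → when (u ≟ 0#) 1#)         ≡⟨ ∑-when-≡ 0# (λ _ → 1#) ⟩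
    1#                                   ≡⟨ sym (trans (cong (1# +_) χ0≡0) (+-identityʳ 1#)) ⟩
    1# + χ 0#                            ∎
  ... | no z≢0 | yes (u₀ , u₀²) = begin
    ∑ₐ (λ u → when (z ≟ (u * u)) 1#)   ≡⟨ AddF.∑-when-pair (λ u → z ≟ (u * u)) u₀ (- u₀) (x≢-x u₀ u₀≢0) (sym u₀²)
                                            (trans (sym u₀²) (sym (-x*-x≡x*x u₀))) (square-roots u₀²) 1# ⟩
    1# + 1#                             ≡⟨ cong (1# +_) (sym (χ[square]≡1 z z≢0 (u₀ , u₀²))) ⟩
    1# + χ z                            ∎
    where
    u₀≢0 : ¬ (u₀ ≡ 0#)
    u₀≢0 = root-≢0 z≢0 u₀²
  ... | no z≢0 | no ¬□ = begin
    ∑ₐ (λ u → when (z ≟ (u * u)) 1#)   ≡⟨ ∑-vanishing elements _ (λ u _ → when-no (z ≟ (u * u)) (λ z≡u² → ¬□ (u , sym z≡u²)) 1#) ⟩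
    0#                                  ≡⟨ sym (-‿inverseʳ 1#) ⟩
    1# + - 1#                           ≡⟨ cong (1# +_) (sym (χ[nonsquare]≡-1 z z≢0 ¬□)) ⟩
    1# + χ z                            ∎

  ∑-square-substitution : ∀ (G : Carrier → Carrier) → ∑ₐ (λ u → G (u * u)) ≡ ∑ₐ (λ z → G z * (1# + χ z))
  ∑-square-substitution G = begin
    ∑ₐ (λ u → G (u * u))                               ≡⟨ ∑-cong elements (λ u → sym (∑-when-≡ (u * u) G)) ⟩
    ∑ₐ (λ u → ∑ₐ (λ z → when (z ≟ (u * u)) (G z)))    ≡⟨ ∑-comm elements elements _ ⟩
    ∑ₐ (λ z → ∑ₐ (λ u → when (z ≟ (u * u)) (G z)))    ≡⟨ ∑-cong elements fibre ⟩
    ∑ₐ (λ z → G z * (1# + χ z))                        ∎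
    where
    fibre : ∀ z → ∑ₐ (λ u → when (z ≟ (u * u)) (G z)) ≡ G z * (1# + χ z)
    fibre z = begin
      ∑ₐ (λ u → when (z ≟ (u * u)) (G z))         ≡⟨ ∑-cong elements (λ u → when≡*when1 (z ≟ (u * u)) (G z)) ⟩
      ∑ₐ (λ u → G z * when (z ≟ (u * u)) 1#)      ≡⟨ ∑-*ˡ elements _ (G z) ⟩
      G z * ∑ₐ (λ u → when (z ≟ (u * u)) 1#)      ≡⟨ cong (G z *_) (#square-roots≡1+χ z) ⟩
      G z * (1# + χ z)                             ∎

  2*[square]≡1+χ+δ : ∀ t → fromℕ 2 * when (isSquare? t) 1# ≡ 1# + χ t + δ t
  2*[square]≡1+χ+δ t with t ≟ 0# | isSquare? t
  ... | yes refl | no ¬□ = ⊥-elim (¬□ (0# , zeroˡ 0#))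
  ... | yes refl | yes _ = begin
    fromℕ 2 * 1#        ≡⟨ solve 0 (con (ℤ.+ 2) :* con ℤ.1ℤ := con ℤ.1ℤ :+ con ℤ.0ℤ :+ con ℤ.1ℤ) refl ⟩
    1# + 0# + 1#        ≡⟨ cong (λ t → 1# + t + 1#) (sym χ0≡0) ⟩
    1# + χ 0# + 1#      ∎
  ... | no t≢0 | yes □ = begin
    fromℕ 2 * 1#        ≡⟨ solve 0 (con (ℤ.+ 2) :* con ℤ.1ℤ := con ℤ.1ℤ :+ con ℤ.1ℤ :+ con ℤ.0ℤ) refl ⟩
    1# + 1# + 0#        ≡⟨ cong (λ s → 1# + s + 0#) (sym (χ[square]≡1 t t≢0 □)) ⟩
    1# + χ t + 0#       ∎
  ... | no t≢0 | no ¬□ = begin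
    fromℕ 2 * 0#        ≡⟨ solve 0 (con (ℤ.+ 2) :* con ℤ.0ℤ := con ℤ.1ℤ :+ :- con ℤ.1ℤ :+ con ℤ.0ℤ) refl ⟩
    1# + - 1# + 0#      ≡⟨ cong (λ s → 1# + s + 0#) (sym (χ[nonsquare]≡-1 t t≢0 ¬□)) ⟩
    1# + χ t + 0#       ∎

  #linear-solutions≡1 : ∀ A B → ¬ (A ≡ 0#) → ∑ₐ (λ w → when ((A * w + B) ≟ 0#) 1#) ≡ 1#
  #linear-solutions≡1 A B A≢0 =
    ∑-when-unique (λ w → (A * w + B) ≟ 0#) elements unique w₀ (complete w₀) Aw₀+B≡0 solution-unique (λ _ → 1#)
    where
    w₀ : Carrier
    w₀ = A ⁻¹ * - B
    Aw₀+B≡0 : A * w₀ + B ≡ 0#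
    Aw₀+B≡0 = trans (cong (_+ B) (x*[x⁻¹*y]≡y A A≢0 (- B))) (-‿inverseˡ B)
    solution-unique : ∀ w → A * w + B ≡ 0# → w ≡ w₀
    solution-unique w Aw+B≡0 = trans (sym (x⁻¹*[x*y]≡y A A≢0 w)) (cong (A ⁻¹ *_) (+-inverseˡ-unique _ _ Aw+B≡0))

  w²-D≡[w+m]²? : ∀ D w m → Dec (w * w + - D ≡ (w + m) * (w + m))
  w²-D≡[w+m]²? D w m = (w * w + - D) ≟ ((w + m) * (w + m))

  w²-D≡[w+m]²⇒linear : ∀ D w m → w * w + - D ≡ (w + m) * (w + m) → fromℕ 2 * m * w + (m * m + D) ≡ 0#
  w²-D≡[w+m]²⇒linear D w m eq = begin
    fromℕ 2 * m * w + (m * m + D)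
      ≡⟨ solve 3 (λ m w D → con (ℤ.+ 2) :* m :* w :+ (m :* m :+ D) := (w :+ m) :* (w :+ m) :+ :- (w :* w :+ :- D)) refl m w D ⟩
    (w + m) * (w + m) + - (w * w + - D)
      ≡⟨ cong (λ t → (w + m) * (w + m) + - t) eq ⟩
    (w + m) * (w + m) + - ((w + m) * (w + m))
      ≡⟨ -‿inverseʳ _ ⟩
    0# ∎

  linear⇒w²-D≡[w+m]² : ∀ D w m → fromℕ 2 * m * w + (m * m + D) ≡ 0# → w * w + - D ≡ (w + m) * (w + m)
  linear⇒w²-D≡[w+m]² D w m eq = begin
    w * w + - D
      ≡⟨ sym (trans (cong ((w * w + - D) +_) eq) (+-identityʳ _)) ⟩
    (w * w + - D) + (fromℕ 2 * m * w + (m * m + D))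
      ≡⟨ solve 3 (λ m w D → (w :* w :+ :- D) :+ (con (ℤ.+ 2) :* m :* w :+ (m :* m :+ D)) := (w :+ m) :* (w :+ m)) refl m w D ⟩
    (w + m) * (w + m) ∎

  #w²-D≡[w+m]²≡1-δ : ∀ D → ¬ (D ≡ 0#) → ∀ m → ∑ₐ (λ w → when (w²-D≡[w+m]²? D w m) 1#) ≡ 1# + - δ m
  #w²-D≡[w+m]²≡1-δ D D≢0 m with m ≟ 0#
  ... | yes refl = begin
    ∑ₐ (λ w → when (w²-D≡[w+m]²? D w 0#) 1#)   ≡⟨ ∑-vanishing elements _ (λ w _ → when-no (w²-D≡[w+m]²? D w 0#) (λ eq → D≢0 (D≡0 w eq)) 1#) ⟩
    0#                                          ≡⟨ sym (-‿inverseʳ 1#) ⟩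
    1# + - 1#                                   ∎
    where
    D≡0 : ∀ w → w * w + - D ≡ (w + 0#) * (w + 0#) → D ≡ 0#
    D≡0 w eq = trans (solve 2 (λ w D → D := con (ℤ.+ 2) :* con ℤ.0ℤ :* w :+ (con ℤ.0ℤ :* con ℤ.0ℤ :+ D)) refl w D)
                     (w²-D≡[w+m]²⇒linear D w 0# eq)
  ... | no m≢0 = begin
    ∑ₐ (λ w → when (w²-D≡[w+m]²? D w m) 1#)                       ≡⟨ ∑-cong elements (λ w → when-cong (w²-D≡[w+m]²? D w m) (_ ≟ 0#)
                                                                        (w²-D≡[w+m]²⇒linear D w m) (linear⇒w²-D≡[w+m]² D w m) 1#) ⟩
    ∑ₐ (λ w → when ((fromℕ 2 * m * w + (m * m + D)) ≟ 0#) 1#)     ≡⟨ #linear-solutions≡1 (fromℕ 2 * m) (m * m + D) (*-≢0 2≢0 m≢0) ⟩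
    1#                                                            ≡⟨ sym (trans (cong (1# +_) -0#≈0#) (+-identityʳ 1#)) ⟩
    1# + - 0#                                                     ∎

  -- Writing the square roots of w² - D as w + m.
  ∑-χ[w²-D]≡-1 : ∀ D → ¬ (D ≡ 0#) → ∑ₐ (λ w → χ (w * w + - D)) ≡ - 1#
  ∑-χ[w²-D]≡-1 D D≢0 = +-cancelˡ 0# _ _ (begin
    0# + ∑ₐ (λ w → χ (w * w + - D))
      ≡⟨ cong (_+ ∑ₐ (λ w → χ (w * w + - D))) (sym (∑ₐ-const 1#)) ⟩
    ∑ₐ (λ _ → 1#) + ∑ₐ (λ w → χ (w * w + - D))
      ≡⟨ sym (∑-distrib elements _ _) ⟩
    ∑ₐ (λ w → 1# + χ (w * w + - D))
      ≡⟨ ∑-cong elements (λ w → sym (#square-roots≡1+χ (w * w + - D))) ⟩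
    ∑ₐ (λ w → ∑ₐ (λ y → when ((w * w + - D) ≟ (y * y)) 1#))
      ≡⟨ ∑-cong elements (λ w → sym (∑-reindex (w +_) (_+ - w)
         (λ m → solve 2 (λ w m → w :+ m :+ :- w := m) refl w m)
                                                                   (λ y → solve 2 (λ w y → w :+ (y :+ :- w) := y) refl w y) _)) ⟩
    ∑ₐ (λ w → ∑ₐ (λ m → when (w²-D≡[w+m]²? D w m) 1#))
      ≡⟨ ∑-comm elements elements _ ⟩
    ∑ₐ (λ m → ∑ₐ (λ w → when (w²-D≡[w+m]²? D w m) 1#))
      ≡⟨ ∑-cong elements (#w²-D≡[w+m]²≡1-δ D D≢0) ⟩
    ∑ₐ (λ m → 1# + - δ m)
      ≡⟨ ∑-distrib elements _ _ ⟩
    ∑ₐ (λ _ → 1#) + ∑ₐ (λ m → - δ m)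
      ≡⟨ cong₂ _+_ (∑ₐ-const 1#) (trans (∑-neg elements δ) (cong -_ (∑-when-≡ 0# (λ _ → 1#)))) ⟩
    0# + - 1# ∎)

  ½ : Carrier
  ½ = fromℕ 2 ⁻¹

  x≡2*[x*½] : ∀ x → x ≡ fromℕ 2 * (x * ½)
  x≡2*[x*½] x = begin
    x                      ≡⟨ sym (*-identityʳ x) ⟩
    x * 1#                 ≡⟨ cong (x *_) (sym (inverseʳ (fromℕ 2) 2≢0)) ⟩
    x * (fromℕ 2 * ½)      ≡⟨ solve 3 (λ x t i → x :* (t :* i) := t :* (x :* i)) refl x (fromℕ 2) ½ ⟩
    fromℕ 2 * (x * ½)      ∎

  -- Centre at e = H / 2: z (H - z) = e² - (z - e)².
  ∑-χ[z*[H-z]]≡-χ[-1] : ∀ H → ¬ (H ≡ 0#) → ∑ₐ (λ z → χ (z * (H + - z))) ≡ - χ (- 1#)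
  ∑-χ[z*[H-z]]≡-χ[-1] H H≢0 = begin
    ∑ₐ (λ z → χ (z * (H + - z)))                 ≡⟨ sym (∑-reindex (_+ e) (_+ - e) (λ w → solve 2 (λ w e → w :+ e :+ :- e := w) refl w e)
                                                      (λ w → solve 2 (λ w e → w :+ :- e :+ e := w) refl w e) _) ⟩
    ∑ₐ (λ w → χ ((w + e) * (H + - (w + e))))     ≡⟨ ∑-cong elements (λ w → cong χ (centred w)) ⟩
    ∑ₐ (λ w → χ (- 1# * (w * w + - (e * e))))    ≡⟨ ∑-cong elements (λ w → χ-* (- 1#) _) ⟩
    ∑ₐ (λ w → χ (- 1#) * χ (w * w + - (e * e)))  ≡⟨ ∑-*ˡ elements _ _ ⟩
    χ (- 1#) * ∑ₐ (λ w → χ (w * w + - (e * e)))  ≡⟨ cong (χ (- 1#) *_) (∑-χ[w²-D]≡-1 (e * e) (*-≢0 e≢0 e≢0)) ⟩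
    χ (- 1#) * - 1#                              ≡⟨ solve 1 (λ x → x :* :- con ℤ.1ℤ := :- x) refl _ ⟩
    - χ (- 1#)                                   ∎
    where
    e : Carrier
    e = H * ½
    e≢0 : ¬ (e ≡ 0#)
    e≢0 e≡0 = H≢0 (trans (x≡2*[x*½] H) (trans (cong (fromℕ 2 *_) e≡0) (zeroʳ _)))
    centred : ∀ w → (w + e) * (H + - (w + e)) ≡ - 1# * (w * w + - (e * e))
    centred w = begin
      (w + e) * (H + - (w + e))
        ≡⟨ cong (λ t → (w + e) * (t + - (w + e))) (x≡2*[x*½] H) ⟩
      (w + e) * (fromℕ 2 * e + - (w + e))
        ≡⟨ solve 2 (λ w e → (w :+ e) :* (con (ℤ.+ 2) :* e :+ :- (w :+ e)) := :- con ℤ.1ℤ :* (w :* w :+ :- (e :* e))) refl w e ⟩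
      - 1# * (w * w + - (e * e)) ∎

  -- Pair z with its reflection H - z.
  ∑-reflect : ∀ H (ψ : Carrier → Carrier) → (∀ z → ψ (H + - z) ≡ ψ z) →
              fromℕ 2 * ∑ₐ (λ z → z * ψ z) ≡ H * ∑ₐ ψ
  ∑-reflect H ψ ψ-symmetric = begin
    fromℕ 2 * Y
      ≡⟨ solve 1 (λ y → con (ℤ.+ 2) :* y := y :+ y) refl Y ⟩
    Y + Y
      ≡⟨ cong (Y +_) (sym (∑-reindex (λ z → H + - z) (λ z → H + - z) reflect² reflect² _)) ⟩
    Y + ∑ₐ (λ z → (H + - z) * ψ (H + - z))
      ≡⟨ cong (Y +_) (∑-cong elements (λ z → cong ((H + - z) *_) (ψ-symmetric z))) ⟩
    Y + ∑ₐ (λ z → (H + - z) * ψ z)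
      ≡⟨ cong (Y +_) (∑-cong elements (λ z → solve 3 (λ H z p → (H :+ :- z) :* p := H :* p :+ :- (z :* p)) refl H z (ψ z))) ⟩
    Y + ∑ₐ (λ z → H * ψ z + - (z * ψ z))
      ≡⟨ cong (Y +_) (trans (∑-distrib elements _ _) (cong₂ _+_ (∑-*ˡ elements ψ H) (∑-neg elements _))) ⟩
    Y + (H * ∑ₐ ψ + - Y)
      ≡⟨ solve 2 (λ y x → y :+ (x :+ :- y) := x) refl Y (H * ∑ₐ ψ) ⟩
    H * ∑ₐ ψ ∎
    where
    Y : Carrier
    Y = ∑ₐ (λ z → z * ψ z)
    reflect² : ∀ z → H + - (H + - z) ≡ z
    reflect² z = solve 2 (λ H z → H :+ :- (H :+ :- z) := z) refl H z

  -- A nonzero square has two square roots and 0 has one, hence the correction at z = 0.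
  2*∑-over-squares : ∀ {p} {P : Carrier → Set p} (P? : Decidable P) → (∀ z → P z → IsSquare z) →
                     (g : Carrier → Carrier) →
                     fromℕ 2 * ∑ₐ (λ z → when (P? z) (g z))
                       ≡ ∑ₐ (λ u → when (P? (u * u)) (g (u * u))) + when (P? 0#) (g 0#)
  2*∑-over-squares P? P⊆□ g = begin
    fromℕ 2 * ∑ₐ (λ z → when (P? z) (g z))
      ≡⟨ sym (∑-*ˡ elements _ (fromℕ 2)) ⟩
    ∑ₐ (λ z → fromℕ 2 * when (P? z) (g z))
      ≡⟨ ∑-cong elements twice ⟩
    ∑ₐ (λ z → when (P? z) (g z) * (1# + χ z) + when (z ≟ 0#) (when (P? 0#) (g 0#)))
      ≡⟨ ∑-distrib elements _ _ ⟩
    ∑ₐ (λ z → when (P? z) (g z) * (1# + χ z)) + ∑ₐ (λ z → when (z ≟ 0#) (when (P? 0#) (g 0#)))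
      ≡⟨ cong₂ _+_ (sym (∑-square-substitution (λ z → when (P? z) (g z)))) (∑-when-≡ 0# (λ _ → when (P? 0#) (g 0#))) ⟩
    ∑ₐ (λ u → when (P? (u * u)) (g (u * u))) + when (P? 0#) (g 0#)
      ∎
    where
    twice : ∀ z → fromℕ 2 * when (P? z) (g z) ≡ when (P? z) (g z) * (1# + χ z) + when (z ≟ 0#) (when (P? 0#) (g 0#))
    twice z with z ≟ 0#
    ... | yes refl = trans (solve 1 (λ w → con (ℤ.+ 2) :* w := w :* (con ℤ.1ℤ :+ con ℤ.0ℤ) :+ w) refl _)
                           (cong (λ t → when (P? 0#) (g 0#) * (1# + t) + when (P? 0#) (g 0#)) (sym χ0≡0))
    ... | no z≢0 with P? z
    ...   | yes Pz = trans (solve 1 (λ w → con (ℤ.+ 2) :* w := w :* (con ℤ.1ℤ :+ con ℤ.1ℤ) :+ con ℤ.0ℤ) refl (g z))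
                           (cong (λ t → g z * (1# + t) + 0#) (sym (χ[square]≡1 z z≢0 (P⊆□ z Pz))))
    ...   | no _   = solve 1 (λ x → con (ℤ.+ 2) :* con ℤ.0ℤ := con ℤ.0ℤ :* (con ℤ.1ℤ :+ x) :+ con ℤ.0ℤ) refl (χ z)

  module _ (5<size : 5 ℕ.< size) where

    3≤half : 3 ℕ.≤ half
    3≤half = at-least-3 half (subst (5 ℕ.<_) size≡1+half+half 5<size)
      where
      at-least-3 : ∀ n → 5 ℕ.< suc (n ℕ.+ n) → 3 ℕ.≤ n
      at-least-3 (suc (suc (suc n))) _ = s≤s (s≤s (s≤s z≤n))
      at-least-3 0 (s≤s ())
      at-least-3 1 (s≤s (s≤s (s≤s ())))
      at-least-3 2 (s≤s (s≤s (s≤s (s≤s (s≤s ())))))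

    ∑-x^m≡0-below : ∀ m → 1 ℕ.≤ m → m ℕ.≤ half ℕ.+ 2 → ∑ₐ (λ x → x ^ m) ≡ 0#
    ∑-x^m≡0-below m 1≤m m≤half+2 = ∑-x^m≡0 m 1≤m (subst (2 ℕ.+ m ℕ.≤_) (sym size≡1+half+half)
      (ℕ.≤-trans (ℕ.+-monoʳ-≤ 2 m≤half+2) (s≤s (ℕ.≤-trans (ℕ.≤-reflexive (ℕ.+-comm 1 (half ℕ.+ 2)))
        (ℕ.≤-trans (ℕ.≤-reflexive (ℕ.+-assoc half 2 1)) (ℕ.+-monoʳ-≤ half 3≤half))))))

    ∑-quadratic≡0 : ∀ α β γ → ∑ₐ (λ t → α * (t * t) + β * t + γ) ≡ 0#
    ∑-quadratic≡0 α β γ = begin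
      ∑ₐ (λ t → α * (t * t) + β * t + γ)
        ≡⟨ trans (∑-distrib elements _ _) (cong₂ _+_ (∑-distrib elements _ _) (∑ₐ-const γ)) ⟩
      ∑ₐ (λ t → α * (t * t)) + ∑ₐ (λ t → β * t) + 0#
        ≡⟨ cong (_+ 0#) (cong₂ _+_ (∑-*ˡ elements _ α) (∑-*ˡ elements _ β)) ⟩
      α * ∑ₐ (λ t → t * t) + β * ∑ₐ (λ t → t) + 0#
        ≡⟨ cong₂ (λ s₂ s₁ → α * s₂ + β * s₁ + 0#) ∑t² ∑t ⟩
      α * 0# + β * 0# + 0#
        ≡⟨ solve 2 (λ a b → a :* con ℤ.0ℤ :+ b :* con ℤ.0ℤ :+ con ℤ.0ℤ := con ℤ.0ℤ) refl α β ⟩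
      0# ∎
      where
      ∑t² : ∑ₐ (λ t → t * t) ≡ 0#
      ∑t² = trans (∑-cong elements (λ t → cong (t *_) (sym (*-identityʳ t)))) (∑-x^m≡0-below 2 (s≤s z≤n) (ℕ.m≤n+m 2 half))
      ∑t : ∑ₐ (λ t → t) ≡ 0#
      ∑t = trans (∑-cong elements (λ t → sym (*-identityʳ t))) (∑-x^m≡0-below 1 (s≤s z≤n) (ℕ.≤-trans (s≤s z≤n) (ℕ.m≤n+m 2 half)))

    -- χ t = t^half, so the summand is a combination of t^half, t^(half+1), t^(half+2).
    ∑-quadratic*χ≡0 : ∀ α β γ → ∑ₐ (λ t → (α * (t * t) + β * t + γ) * χ t) ≡ 0#
    ∑-quadratic*χ≡0 α β γ = begin
      ∑ₐ (λ t → (α * (t * t) + β * t + γ) * χ t)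
        ≡⟨ ∑-cong elements (λ t → solve 5 (λ α β γ t w → (α :* (t :* t) :+ β :* t :+ γ) :* w := α :* (t :* (t :* w)) :+ β :* (t :* w) :+ γ :* w) refl α β γ t (χ t)) ⟩
      ∑ₐ (λ t → α * t ^ (2 ℕ.+ half) + β * t ^ (1 ℕ.+ half) + γ * t ^ half)
        ≡⟨ trans (∑-distrib elements _ _) (cong₂ _+_ (∑-distrib elements _ _) (∑-*ˡ elements _ γ)) ⟩
      ∑ₐ (λ t → α * t ^ (2 ℕ.+ half)) + ∑ₐ (λ t → β * t ^ (1 ℕ.+ half)) + γ * ∑ₐ (λ t → t ^ half)
        ≡⟨ cong (_+ γ * ∑ₐ (λ t → t ^ half)) (cong₂ _+_ (∑-*ˡ elements _ α) (∑-*ˡ elements _ β)) ⟩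
      α * ∑ₐ (λ t → t ^ (2 ℕ.+ half)) + β * ∑ₐ (λ t → t ^ (1 ℕ.+ half)) + γ * ∑ₐ (λ t → t ^ half)
        ≡⟨ cong₂ _+_ (cong₂ _+_ (cong (α *_) (∑-x^m≡0-below (2 ℕ.+ half) (s≤s z≤n) (ℕ.≤-reflexive (ℕ.+-comm 2 half))))
           (cong (β *_) (∑-x^m≡0-below (1 ℕ.+ half) (s≤s z≤n) (ℕ.≤-trans (ℕ.n≤1+n _) (ℕ.≤-reflexive (ℕ.+-comm 2 half))))))
                     (cong (γ *_) (∑-x^m≡0-below half 1≤half (ℕ.m≤m+n half 2))) ⟩
      α * 0# + β * 0# + γ * 0#
        ≡⟨ solve 3 (λ a b c → a :* con ℤ.0ℤ :+ b :* con ℤ.0ℤ :+ c :* con ℤ.0ℤ := con ℤ.0ℤ) refl α β γ ⟩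
      0# ∎

module QuarticValueSum {ℓ} (F : FiniteField ℓ) (size-odd : FiniteField.size F % 2 ≡ 1)
                       (5<size : 5 ℕ.< FiniteField.size F)
                       (a b : FiniteField.Carrier F) (a≢0 : ¬ (a ≡ FiniteField.0# F)) where
  open OddOrder F size-odd
  open ≡-Reasoning

  h : Carrier
  h = a * ½

  c : Carrier
  c = b + - (h * h)

  a≡2h : a ≡ fromℕ 2 * h
  a≡2h = x≡2*[x*½] a

  h≢0 : ¬ (h ≡ 0#)
  h≢0 h≡0 = a≢0 (trans a≡2h (trans (cong (fromℕ 2 *_) h≡0) (zeroʳ _)))

  f : Carrier → Carrier
  f x = x ^ 4 + a * x ^ 2 + b

  f≡[x²+h]²+c : ∀ x → f x ≡ (x * x + h) * (x * x + h) + c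
  f≡[x²+h]²+c x = begin
    x ^ 4 + a * x ^ 2 + b
      ≡⟨ cong (λ t → x ^ 4 + t * x ^ 2 + b) a≡2h ⟩
    x ^ 4 + (fromℕ 2 * h) * x ^ 2 + b
      ≡⟨ solve 3 (λ x h b → x :* (x :* (x :* (x :* con ℤ.1ℤ))) :+ (con (ℤ.+ 2) :* h) :* (x :* (x :* con ℤ.1ℤ)) :+ b
                 := (x :* x :+ h) :* (x :* x :+ h) :+ (b :+ :- (h :* h))) refl x h b ⟩
    (x * x + h) * (x * x + h) + c ∎

  Value : Carrier → Set ℓ
  Value y = ∃ λ x → f x ≡ y

  value? : Decidable Value
  value? y = ∃? (λ x → f x ≟ y)

  [x²+h]²≡z : ∀ {x z} → f x ≡ z + c → (x * x + h) * (x * x + h) ≡ z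
  [x²+h]²≡z {x} fx≡z+c = +-cancelʳ c _ _ (trans (sym (f≡[x²+h]²+c x)) fx≡z+c)

  x+h≡y⇒x≡y-h : ∀ {x y} → x + h ≡ y → x ≡ y + - h
  x+h≡y⇒x≡y-h {x} refl = solve 2 (λ x h → x := x :+ h :+ :- h) refl x h

  value[z+c]⇒square : ∀ z → Value (z + c) → IsSquare z
  value[z+c]⇒square z (x , fx≡z+c) = x * x + h , [x²+h]²≡z fx≡z+c

  value⇒root : ∀ u → Value (u * u + c) → IsSquare (u + - h) ⊎ IsSquare (- u + - h)
  value⇒root u (x , fx≡u²+c) with x*x≡y*y⇒x≡y⊎x≡-y (x * x + h) u ([x²+h]²≡z fx≡u²+c)
  ... | inj₁ x²+h≡u  = inj₁ (x , x+h≡y⇒x≡y-h x²+h≡u)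
  ... | inj₂ x²+h≡-u = inj₂ (x , x+h≡y⇒x≡y-h x²+h≡-u)

  root⇒value : ∀ u → IsSquare (u + - h) ⊎ IsSquare (- u + - h) → Value (u * u + c)
  root⇒value u (inj₁ (x , x²≡u-h)) = x , (begin
    f x                                     ≡⟨ f≡[x²+h]²+c x ⟩
    (x * x + h) * (x * x + h) + c           ≡⟨ cong (λ t → (t + h) * (t + h) + c) x²≡u-h ⟩
    (u + - h + h) * (u + - h + h) + c       ≡⟨ solve 3 (λ u h c → (u :+ :- h :+ h) :* (u :+ :- h :+ h) :+ c := u :* u :+ c) refl u h c ⟩
    u * u + c                               ∎)
  root⇒value u (inj₂ (x , x²≡-u-h)) = x , (begin
    f x                                     ≡⟨ f≡[x²+h]²+c x ⟩
    (x * x + h) * (x * x + h) + c           ≡⟨ cong (λ t → (t + h) * (t + h) + c) x²≡-u-h ⟩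
    (- u + - h + h) * (- u + - h + h) + c   ≡⟨ solve 3 (λ u h c → (:- u :+ :- h :+ h) :* (:- u :+ :- h :+ h) :+ c := u :* u :+ c) refl u h c ⟩
    u * u + c                               ∎)

  value[c]⇒square[-h] : Value (0# + c) → IsSquare (- h)
  value[c]⇒square[-h] (x , fx≡c) = x , +-inverseˡ-unique _ _ (x*x≡0⇒x≡0 _ ([x²+h]²≡z fx≡c))

  square[-h]⇒value[c] : IsSquare (- h) → Value (0# + c)
  square[-h]⇒value[c] (x , x²≡-h) = x , (begin
    f x                                     ≡⟨ f≡[x²+h]²+c x ⟩
    (x * x + h) * (x * x + h) + c           ≡⟨ cong (λ t → (t + h) * (t + h) + c) x²≡-h ⟩
    (- h + h) * (- h + h) + c               ≡⟨ solve 2 (λ h c → (:- h :+ h) :* (:- h :+ h) :+ c := con ℤ.0ℤ :+ c) refl h c ⟩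
    0# + c                                  ∎)

  G : Carrier → Carrier
  G u = u * u + c

  J : Carrier → Carrier
  J t = when (isSquare? t) 1#

  Q : Carrier → Carrier
  Q u = J (u + - h) + J (- u + - h) + - (J (u + - h) * J (- u + - h))

  -- y = f x is y - c = u² with u = ± (x² + h), i.e. u - h or - u - h is a square;
  -- Q u is the indicator of this union.
  2*S≡∑G*Q+c*J[-h] : fromℕ 2 * S f ≡ ∑ₐ (λ u → G u * Q u) + c * J (- h)
  2*S≡∑G*Q+c*J[-h] = begin
    fromℕ 2 * S f
      ≡⟨ cong (fromℕ 2 *_) (trans (S≡∑-values f) (sym (∑-reindex (_+ c) (_+ - c)
           (λ z → solve 2 (λ z c → z :+ c :+ :- c := z) refl z c) (λ y → solve 2 (λ y c → y :+ :- c :+ c := y) refl y c) _))) ⟩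
    fromℕ 2 * ∑ₐ (λ z → when (value? (z + c)) (z + c))
      ≡⟨ 2*∑-over-squares (λ z → value? (z + c)) value[z+c]⇒square (_+ c) ⟩
    ∑ₐ (λ u → when (value? (u * u + c)) (u * u + c)) + when (value? (0# + c)) (0# + c)
      ≡⟨ cong₂ _+_ (∑-cong elements (λ u → when-∪ (value? (u * u + c)) (isSquare? (u + - h)) (isSquare? (- u + - h))
         (value⇒root u) (root⇒value u) (G u)))
                   (trans (when≡*when1 (value? (0# + c)) (0# + c))
                          (cong₂ _*_ (+-identityˡ c) (when-cong (value? (0# + c)) (isSquare? (- h)) value[c]⇒square[-h] square[-h]⇒value[c] 1#))) ⟩
    ∑ₐ (λ u → G u * Q u) + c * J (- h)
      ∎

  B : Carrier → Carrier
  B t = χ t + δ t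

  B₁ B₂ : Carrier → Carrier
  B₁ u = B (u + - h)
  B₂ u = B (- u + - h)

  -- 2 J = 1 + B, and 4 Q is a polynomial in 2 J (u - h) and 2 J (- u - h).
  4*Q≡3+B₁+B₂-B₁*B₂ : ∀ u → fromℕ 4 * Q u ≡ fromℕ 3 + B₁ u + B₂ u + - (B₁ u * B₂ u)
  4*Q≡3+B₁+B₂-B₁*B₂ u = begin
    fromℕ 4 * Q u
      ≡⟨ solve 2 (λ j k → con (ℤ.+ 4) :* (j :+ k :+ :- (j :* k))
                 := con (ℤ.+ 2) :* (con (ℤ.+ 2) :* j) :+ con (ℤ.+ 2) :* (con (ℤ.+ 2) :* k) :+ :- ((con (ℤ.+ 2) :* j) :* (con (ℤ.+ 2) :* k))) refl (J (u + - h)) (J (- u + - h)) ⟩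
    fromℕ 2 * (fromℕ 2 * J (u + - h)) + fromℕ 2 * (fromℕ 2 * J (- u + - h)) + - ((fromℕ 2 * J (u + - h)) * (fromℕ 2 * J (- u + - h)))
      ≡⟨ cong₂ (λ s t → fromℕ 2 * s + fromℕ 2 * t + - (s * t)) (2*[square]≡1+χ+δ (u + - h)) (2*[square]≡1+χ+δ (- u + - h)) ⟩
    fromℕ 2 * (1# + χ (u + - h) + δ (u + - h)) + fromℕ 2 * (1# + χ (- u + - h) + δ (- u + - h))
      + - ((1# + χ (u + - h) + δ (u + - h)) * (1# + χ (- u + - h) + δ (- u + - h)))
      ≡⟨ solve 4 (λ x d y e → con (ℤ.+ 2) :* (con ℤ.1ℤ :+ x :+ d) :+ con (ℤ.+ 2) :* (con ℤ.1ℤ :+ y :+ e) :+ :- ((con ℤ.1ℤ :+ x :+ d) :* (con ℤ.1ℤ :+ y :+ e))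
                 := con (ℤ.+ 3) :+ (x :+ d) :+ (y :+ e) :+ :- ((x :+ d) :* (y :+ e))) refl
                 (χ (u + - h)) (δ (u + - h)) (χ (- u + - h)) (δ (- u + - h)) ⟩
    fromℕ 3 + B₁ u + B₂ u + - (B₁ u * B₂ u)
      ∎

  4*∑G*Q≡ : fromℕ 4 * ∑ₐ (λ u → G u * Q u)
            ≡ fromℕ 3 * ∑ₐ G + ∑ₐ (λ u → G u * B₁ u) + ∑ₐ (λ u → G u * B₂ u) + - ∑ₐ (λ u → G u * (B₁ u * B₂ u))
  4*∑G*Q≡ = begin
    fromℕ 4 * ∑ₐ (λ u → G u * Q u)
      ≡⟨ sym (∑-*ˡ elements _ (fromℕ 4)) ⟩
    ∑ₐ (λ u → fromℕ 4 * (G u * Q u))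
      ≡⟨ ∑-cong elements expand ⟩
    ∑ₐ (λ u → fromℕ 3 * G u + G u * B₁ u + G u * B₂ u + - (G u * (B₁ u * B₂ u)))
      ≡⟨ trans (∑-distrib elements _ _) (cong₂ _+_ (trans (∑-distrib elements _ _) (cong₂ _+_ (∑-distrib elements _ _) refl)) (∑-neg elements _)) ⟩
    ∑ₐ (λ u → fromℕ 3 * G u) + ∑ₐ (λ u → G u * B₁ u) + ∑ₐ (λ u → G u * B₂ u) + - ∑ₐ (λ u → G u * (B₁ u * B₂ u))
      ≡⟨ cong (λ t → t + ∑ₐ (λ u → G u * B₁ u) + ∑ₐ (λ u → G u * B₂ u) + - ∑ₐ (λ u → G u * (B₁ u * B₂ u))) (∑-*ˡ elements G (fromℕ 3)) ⟩
    fromℕ 3 * ∑ₐ G + ∑ₐ (λ u → G u * B₁ u) + ∑ₐ (λ u → G u * B₂ u) + - ∑ₐ (λ u → G u * (B₁ u * B₂ u))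
      ∎
    where
    expand : ∀ u → fromℕ 4 * (G u * Q u) ≡ fromℕ 3 * G u + G u * B₁ u + G u * B₂ u + - (G u * (B₁ u * B₂ u))
    expand u = begin
      fromℕ 4 * (G u * Q u)
        ≡⟨ solve 2 (λ g q → con (ℤ.+ 4) :* (g :* q) := g :* (con (ℤ.+ 4) :* q)) refl (G u) (Q u) ⟩
      G u * (fromℕ 4 * Q u)
        ≡⟨ cong (G u *_) (4*Q≡3+B₁+B₂-B₁*B₂ u) ⟩
      G u * (fromℕ 3 + B₁ u + B₂ u + - (B₁ u * B₂ u))
        ≡⟨ solve 3 (λ g x y → g :* (con (ℤ.+ 3) :+ x :+ y :+ :- (x :* y)) := con (ℤ.+ 3) :* g :+ g :* x :+ g :* y :+ :- (g :* (x :* y))) refl (G u) (B₁ u) (B₂ u) ⟩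
      fromℕ 3 * G u + G u * B₁ u + G u * B₂ u + - (G u * (B₁ u * B₂ u)) ∎

  ∑G≡0 : ∑ₐ G ≡ 0#
  ∑G≡0 = trans (∑-cong elements (λ u → solve 2 (λ u c → u :* u :+ c := con ℤ.1ℤ :* (u :* u) :+ con ℤ.0ℤ :* u :+ c) refl u c))
               (∑-quadratic≡0 5<size 1# 0# c)

  Gh≡b : G h ≡ b
  Gh≡b = solve 2 (λ h b → h :* h :+ (b :+ :- (h :* h)) := b) refl h b

  G[-h]≡b : G (- h) ≡ b
  G[-h]≡b = solve 2 (λ h b → :- h :* :- h :+ (b :+ :- (h :* h)) := b) refl h b

  u-h≡0⇒u≡h : ∀ u → u + - h ≡ 0# → u ≡ h
  u-h≡0⇒u≡h u = x+-y≡0⇒x≡y u h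

  -u-h≡0⇒u≡-h : ∀ u → - u + - h ≡ 0# → u ≡ - h
  -u-h≡0⇒u≡-h u -u-h≡0 = +-inverseˡ-unique u h (trans (solve 2 (λ u h → u :+ h := :- (:- u :+ :- h)) refl u h)
                                                       (trans (cong -_ -u-h≡0) -0#≈0#))

  -[-h]-h≡0 : - (- h) + - h ≡ 0#
  -[-h]-h≡0 = solve 1 (λ h → :- (:- h) :+ :- h := con ℤ.0ℤ) refl h

  -h-h≡-a : - h + - h ≡ - a
  -h-h≡-a = trans (solve 1 (λ h → :- h :+ :- h := :- (con (ℤ.+ 2) :* h)) refl h) (cong -_ (sym a≡2h))

  -- Shift u = t + h: G (t + h) is a quadratic polynomial in t.
  ∑G*B₁≡b : ∑ₐ (λ u → G u * B₁ u) ≡ b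
  ∑G*B₁≡b = begin
    ∑ₐ (λ u → G u * B₁ u)
      ≡⟨ ∑-cong elements (λ u → distribˡ (G u) _ _) ⟩
    ∑ₐ (λ u → G u * χ (u + - h) + G u * δ (u + - h))
      ≡⟨ ∑-distrib elements _ _ ⟩
    ∑ₐ (λ u → G u * χ (u + - h)) + ∑ₐ (λ u → G u * δ (u + - h))
      ≡⟨ cong₂ _+_ ∑G*χ₁≡0 (∑-*δ G (λ u → u + - h) h (-‿inverseʳ h) u-h≡0⇒u≡h) ⟩
    0# + G h
      ≡⟨ trans (+-identityˡ _) Gh≡b ⟩
    b ∎
    where
    shift : ∀ t → G (t + h) * χ (t + h + - h) ≡ (1# * (t * t) + fromℕ 2 * h * t + (h * h + c)) * χ t
    shift t = cong₂ _*_ (solve 3 (λ t h c → (t :+ h) :* (t :+ h) :+ c := con ℤ.1ℤ :* (t :* t) :+ con (ℤ.+ 2) :* h :* t :+ (h :* h :+ c)) refl t h c)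
                        (cong χ (solve 2 (λ t h → t :+ h :+ :- h := t) refl t h))
    ∑G*χ₁≡0 : ∑ₐ (λ u → G u * χ (u + - h)) ≡ 0#
    ∑G*χ₁≡0 = begin
      ∑ₐ (λ u → G u * χ (u + - h))              ≡⟨ sym (∑-reindex (_+ h) (_+ - h) (λ t → solve 2 (λ t h → t :+ h :+ :- h := t) refl t h)
                                                     (λ u → solve 2 (λ u h → u :+ :- h :+ h := u) refl u h) _) ⟩
      ∑ₐ (λ t → G (t + h) * χ (t + h + - h))    ≡⟨ ∑-cong elements shift ⟩
      ∑ₐ (λ t → (1# * (t * t) + fromℕ 2 * h * t + (h * h + c)) * χ t) ≡⟨ ∑-quadratic*χ≡0 5<size _ _ _ ⟩
      0#                                        ∎

  -- G is even and B₂ (u) = B₁ (- u).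
  ∑G*B₂≡b : ∑ₐ (λ u → G u * B₂ u) ≡ b
  ∑G*B₂≡b = begin
    ∑ₐ (λ u → G u * B₂ u)           ≡⟨ ∑-cong elements (λ u → cong (λ t → (t + c) * B₂ u) (sym (-x*-x≡x*x u))) ⟩
    ∑ₐ (λ u → G (- u) * B₁ (- u))   ≡⟨ ∑-reindex -_ -_ -‿involutive -‿involutive (λ u → G u * B₁ u) ⟩
    ∑ₐ (λ u → G u * B₁ u)           ≡⟨ ∑G*B₁≡b ⟩
    b                               ∎

  X : Carrier
  X = ∑ₐ (λ u → G u * (χ (u + - h) * χ (- u + - h)))

  ∑G*B₁*B₂≡X+2bχ[-a] : ∑ₐ (λ u → G u * (B₁ u * B₂ u)) ≡ X + b * χ (- a) + b * χ (- a) + b * 0#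
  ∑G*B₁*B₂≡X+2bχ[-a] = begin
    ∑ₐ (λ u → G u * (B₁ u * B₂ u))
      ≡⟨ ∑-cong elements (λ u → solve 5 (λ g x d y e → g :* ((x :+ d) :* (y :+ e)) := g :* (x :* y) :+ (g :* x) :* e :+ (g :* y) :* d :+ (g :* e) :* d) refl
         (G u) (χ (u + - h)) (δ (u + - h)) (χ (- u + - h)) (δ (- u + - h))) ⟩
    ∑ₐ (λ u → G u * (χ (u + - h) * χ (- u + - h)) + (G u * χ (u + - h)) * δ (- u + - h) + (G u * χ (- u + - h)) * δ (u + - h) + (G u * δ (- u + - h)) * δ (u + - h))
      ≡⟨ trans (∑-distrib elements _ _) (cong₂ _+_ (trans (∑-distrib elements _ _) (cong₂ _+_ (∑-distrib elements _ _) refl)) refl) ⟩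
    X + ∑ₐ (λ u → (G u * χ (u + - h)) * δ (- u + - h)) + ∑ₐ (λ u → (G u * χ (- u + - h)) * δ (u + - h)) + ∑ₐ (λ u → (G u * δ (- u + - h)) * δ (u + - h))
      ≡⟨ cong₂ _+_ (cong₂ _+_ (cong (X +_) (∑-*δ (λ u → G u * χ (u + - h)) (λ u → - u + - h) (- h) -[-h]-h≡0 -u-h≡0⇒u≡-h))
         (∑-*δ (λ u → G u * χ (- u + - h)) (λ u → u + - h) h (-‿inverseʳ h) u-h≡0⇒u≡h))
                   (∑-*δ (λ u → G u * δ (- u + - h)) (λ u → u + - h) h (-‿inverseʳ h) u-h≡0⇒u≡h) ⟩
    X + G (- h) * χ (- h + - h) + G h * χ (- h + - h) + G h * δ (- h + - h)
      ≡⟨ cong₂ (λ s t → X + s * t + G h * t + G h * δ (- h + - h)) G[-h]≡b (cong χ -h-h≡-a) ⟩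
    X + b * χ (- a) + G h * χ (- a) + G h * δ (- h + - h)
      ≡⟨ cong₂ (λ s t → X + b * χ (- a) + s * χ (- a) + s * t) Gh≡b
               (when-no ((- h + - h) ≟ 0#) (λ e → a≢0 (-x≡0⇒x≡0 (trans (sym -h-h≡-a) e))) 1#) ⟩
    X + b * χ (- a) + b * χ (- a) + b * 0#
      ∎

  H : Carrier → Carrier
  H z = (z + c) * χ (h * h + - z)

  ψ : Carrier → Carrier
  ψ z = χ (z * (h * h + - z))

  -- (u - h) (- u - h) = h² - u², so X is a sum over u of a function of u².
  X≡∑H[u²] : X ≡ ∑ₐ (λ u → H (u * u))
  X≡∑H[u²] = ∑-cong elements (λ u → cong (G u *_) (trans (sym (χ-* _ _))
               (cong χ (solve 2 (λ u h → (u :+ :- h) :* (:- u :+ :- h) := h :* h :+ :- (u :* u)) refl u h))))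

  ∑H≡0 : ∑ₐ H ≡ 0#
  ∑H≡0 = begin
    ∑ₐ H
      ≡⟨ sym (∑-reindex (λ w → h * h + - w) (λ w → h * h + - w) reflect² reflect² H) ⟩
    ∑ₐ (λ w → H (h * h + - w))
      ≡⟨ ∑-cong elements (λ w → cong₂ _*_ (solve 3 (λ s w c → s :+ :- w :+ c := con ℤ.0ℤ :* (w :* w) :+ :- con ℤ.1ℤ :* w :+ (s :+ c)) refl (h * h) w c)
         (cong χ (reflect² w))) ⟩
    ∑ₐ (λ w → (0# * (w * w) + - 1# * w + (h * h + c)) * χ w)
      ≡⟨ ∑-quadratic*χ≡0 5<size _ _ _ ⟩
    0# ∎
    where
    reflect² : ∀ w → h * h + - (h * h + - w) ≡ w
    reflect² w = solve 2 (λ s w → s :+ :- (s :+ :- w) := w) refl (h * h) w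

  ∑H*χ≡∑z*ψ+c*∑ψ : ∑ₐ (λ z → H z * χ z) ≡ ∑ₐ (λ z → z * ψ z) + c * ∑ₐ ψ
  ∑H*χ≡∑z*ψ+c*∑ψ = begin
    ∑ₐ (λ z → H z * χ z)
      ≡⟨ ∑-cong elements (λ z → trans (solve 4 (λ z c p q → (z :+ c) :* p :* q := z :* (p :* q) :+ c :* (p :* q)) refl z c (χ (h * h + - z)) (χ z))
         (cong₂ (λ s t → z * s + c * t) χ-pair χ-pair)) ⟩
    ∑ₐ (λ z → z * ψ z + c * ψ z)
      ≡⟨ trans (∑-distrib elements _ _) (cong (∑ₐ (λ z → z * ψ z) +_) (∑-*ˡ elements ψ c)) ⟩
    ∑ₐ (λ z → z * ψ z) + c * ∑ₐ ψ ∎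
    where
    χ-pair : ∀ {z} → χ (h * h + - z) * χ z ≡ ψ z
    χ-pair {z} = trans (*-comm _ _) (sym (χ-* z _))

  2*X≡ : fromℕ 2 * X ≡ (h * h + fromℕ 2 * c) * - χ (- 1#)
  2*X≡ = begin
    fromℕ 2 * X
      ≡⟨ cong (fromℕ 2 *_) (trans X≡∑H[u²] (∑-square-substitution H)) ⟩
    fromℕ 2 * ∑ₐ (λ z → H z * (1# + χ z))
      ≡⟨ cong (fromℕ 2 *_) (trans (∑-cong elements (λ z → trans (distribˡ (H z) 1# (χ z)) (cong (_+ H z * χ z) (*-identityʳ (H z)))))
         (∑-distrib elements _ _)) ⟩
    fromℕ 2 * (∑ₐ H + ∑ₐ (λ z → H z * χ z))
      ≡⟨ cong₂ (λ s t → fromℕ 2 * (s + t)) ∑H≡0 ∑H*χ≡∑z*ψ+c*∑ψ ⟩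
    fromℕ 2 * (0# + (∑ₐ (λ z → z * ψ z) + c * ∑ₐ ψ))
      ≡⟨ solve 3 (λ y c s → con (ℤ.+ 2) :* (con ℤ.0ℤ :+ (y :+ c :* s)) := con (ℤ.+ 2) :* y :+ con (ℤ.+ 2) :* c :* s) refl _ c _ ⟩
    fromℕ 2 * ∑ₐ (λ z → z * ψ z) + fromℕ 2 * c * ∑ₐ ψ
      ≡⟨ cong (_+ fromℕ 2 * c * ∑ₐ ψ) (∑-reflect (h * h) ψ ψ-symmetric) ⟩
    h * h * ∑ₐ ψ + fromℕ 2 * c * ∑ₐ ψ
      ≡⟨ sym (distribʳ _ _ _) ⟩
    (h * h + fromℕ 2 * c) * ∑ₐ ψ
      ≡⟨ cong ((h * h + fromℕ 2 * c) *_) (∑-χ[z*[H-z]]≡-χ[-1] (h * h) (*-≢0 h≢0 h≢0)) ⟩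
    (h * h + fromℕ 2 * c) * - χ (- 1#) ∎
    where
    ψ-symmetric : ∀ z → ψ (h * h + - z) ≡ ψ z
    ψ-symmetric z = cong χ (solve 2 (λ s z → (s :+ :- z) :* (s :+ :- (s :+ :- z)) := z :* (s :+ :- z)) refl (h * h) z)

  2*J[-h]≡1+χ[-2a] : fromℕ 2 * J (- h) ≡ 1# + χ (- (fromℕ 2 * a)) + 0#
  2*J[-h]≡1+χ[-2a] = begin
    fromℕ 2 * J (- h)              ≡⟨ 2*[square]≡1+χ+δ (- h) ⟩
    1# + χ (- h) + δ (- h)         ≡⟨ cong₂ (λ s t → 1# + s + t) χ[-h]≡χ[-2a] (when-no ((- h) ≟ 0#) (λ -h≡0 → h≢0 (-x≡0⇒x≡0 -h≡0)) 1#) ⟩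
    1# + χ (- (fromℕ 2 * a)) + 0#  ∎
    where
    -- -2a = (-h) · 2², and 2² is a nonzero square.
    χ[-h]≡χ[-2a] : χ (- h) ≡ χ (- (fromℕ 2 * a))
    χ[-h]≡χ[-2a] = sym (begin
      χ (- (fromℕ 2 * a))
        ≡⟨ cong (λ t → χ (- (fromℕ 2 * t))) a≡2h ⟩
      χ (- (fromℕ 2 * (fromℕ 2 * h)))
        ≡⟨ cong χ (solve 1 (λ h → :- (con (ℤ.+ 2) :* (con (ℤ.+ 2) :* h)) := :- h :* (con (ℤ.+ 2) :* con (ℤ.+ 2))) refl h) ⟩
      χ (- h * (fromℕ 2 * fromℕ 2))
        ≡⟨ χ-* _ _ ⟩
      χ (- h) * χ (fromℕ 2 * fromℕ 2)
        ≡⟨ cong (χ (- h) *_) (χ[x*x]≡1 (fromℕ 2) 2≢0) ⟩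
      χ (- h) * 1#
        ≡⟨ *-identityʳ _ ⟩
      χ (- h) ∎)

  64*S≡[h,c] : fromℕ 64 * S f
               ≡ fromℕ 16 * b + - (fromℕ 16 * b * χ (- a)) + fromℕ 16 * c * (1# + χ (- (fromℕ 2 * a)))
                 + - (fromℕ 4 * ((h * h + fromℕ 2 * c) * - χ (- 1#)))
  64*S≡[h,c] = begin
    fromℕ 64 * S f
      ≡⟨ solve 1 (λ s → con (ℤ.+ 64) :* s := con (ℤ.+ 8) :* (con (ℤ.+ 4) :* (con (ℤ.+ 2) :* s))) refl (S f) ⟩
    fromℕ 8 * (fromℕ 4 * (fromℕ 2 * S f))
      ≡⟨ cong (λ t → fromℕ 8 * (fromℕ 4 * t)) 2*S≡∑G*Q+c*J[-h] ⟩
    fromℕ 8 * (fromℕ 4 * (∑ₐ (λ u → G u * Q u) + c * J (- h)))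
      ≡⟨ solve 3 (λ s c j → con (ℤ.+ 8) :* (con (ℤ.+ 4) :* (s :+ c :* j)) := con (ℤ.+ 8) :* (con (ℤ.+ 4) :* s) :+ con (ℤ.+ 16) :* c :* (con (ℤ.+ 2) :* j)) refl _ c _ ⟩
    fromℕ 8 * (fromℕ 4 * ∑ₐ (λ u → G u * Q u)) + fromℕ 16 * c * (fromℕ 2 * J (- h))
      ≡⟨ cong₂ (λ s t → fromℕ 8 * s + fromℕ 16 * c * t) 4*∑G*Q≡ 2*J[-h]≡1+χ[-2a] ⟩
    fromℕ 8 * (fromℕ 3 * ∑ₐ G + ∑ₐ (λ u → G u * B₁ u) + ∑ₐ (λ u → G u * B₂ u) + - ∑ₐ (λ u → G u * (B₁ u * B₂ u)))
      + fromℕ 16 * c * (1# + χ (- (fromℕ 2 * a)) + 0#)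
      ≡⟨ cong (λ t → fromℕ 8 * t + fromℕ 16 * c * (1# + χ (- (fromℕ 2 * a)) + 0#))
              (cong₂ _+_ (cong₂ _+_ (cong₂ _+_ (cong (fromℕ 3 *_) ∑G≡0) ∑G*B₁≡b) ∑G*B₂≡b) (cong -_ ∑G*B₁*B₂≡X+2bχ[-a])) ⟩
    fromℕ 8 * (fromℕ 3 * 0# + b + b + - (X + b * χ (- a) + b * χ (- a) + b * 0#))
      + fromℕ 16 * c * (1# + χ (- (fromℕ 2 * a)) + 0#)
      ≡⟨ solve 5 (λ b c x χa χ2a →
           con (ℤ.+ 8) :* (con (ℤ.+ 3) :* con ℤ.0ℤ :+ b :+ b :+ :- (x :+ b :* χa :+ b :* χa :+ b :* con ℤ.0ℤ))
             :+ con (ℤ.+ 16) :* c :* (con ℤ.1ℤ :+ χ2a :+ con ℤ.0ℤ)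
           := con (ℤ.+ 16) :* b :+ :- (con (ℤ.+ 16) :* b :* χa) :+ con (ℤ.+ 16) :* c :* (con ℤ.1ℤ :+ χ2a)
             :+ :- (con (ℤ.+ 4) :* (con (ℤ.+ 2) :* x)))
         refl b c X (χ (- a)) (χ (- (fromℕ 2 * a))) ⟩
    fromℕ 16 * b + - (fromℕ 16 * b * χ (- a)) + fromℕ 16 * c * (1# + χ (- (fromℕ 2 * a))) + - (fromℕ 4 * (fromℕ 2 * X))
      ≡⟨ cong (λ t → fromℕ 16 * b + - (fromℕ 16 * b * χ (- a)) + fromℕ 16 * c * (1# + χ (- (fromℕ 2 * a))) + - (fromℕ 4 * t)) 2*X≡ ⟩
    fromℕ 16 * b + - (fromℕ 16 * b * χ (- a)) + fromℕ 16 * c * (1# + χ (- (fromℕ 2 * a)))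
      + - (fromℕ 4 * ((h * h + fromℕ 2 * c) * - χ (- 1#))) ∎

  64*S≡ : fromℕ 64 * S f
          ≡ - ((fromℕ 4 + χ (- 1#) + fromℕ 4 * χ (- (fromℕ 2 * a))) * a ^ 2)
            + fromℕ 8 * ((fromℕ 4 + χ (- 1#) + - (fromℕ 2 * χ (- a)) + fromℕ 2 * χ (- (fromℕ 2 * a))) * b)
  64*S≡ = begin
    fromℕ 64 * S f
      ≡⟨ 64*S≡[h,c] ⟩
    fromℕ 16 * b + - (fromℕ 16 * b * χ (- a)) + fromℕ 16 * c * (1# + χ (- (fromℕ 2 * a)))
      + - (fromℕ 4 * ((h * h + fromℕ 2 * c) * - χ (- 1#)))
      ≡⟨ solve 5 (λ b h χ1 χa χ2a →
           con (ℤ.+ 16) :* b :+ :- (con (ℤ.+ 16) :* b :* χa) :+ con (ℤ.+ 16) :* (b :+ :- (h :* h)) :* (con ℤ.1ℤ :+ χ2a)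
             :+ :- (con (ℤ.+ 4) :* ((h :* h :+ con (ℤ.+ 2) :* (b :+ :- (h :* h))) :* :- χ1))
           := :- ((con (ℤ.+ 4) :+ χ1 :+ con (ℤ.+ 4) :* χ2a) :* ((con (ℤ.+ 2) :* h) :* ((con (ℤ.+ 2) :* h) :* con ℤ.1ℤ)))
             :+ con (ℤ.+ 8) :* ((con (ℤ.+ 4) :+ χ1 :+ :- (con (ℤ.+ 2) :* χa) :+ con (ℤ.+ 2) :* χ2a) :* b))
         refl b h (χ (- 1#)) (χ (- a)) (χ (- (fromℕ 2 * a))) ⟩
    - ((fromℕ 4 + χ (- 1#) + fromℕ 4 * χ (- (fromℕ 2 * a))) * (fromℕ 2 * h) ^ 2)
      + fromℕ 8 * ((fromℕ 4 + χ (- 1#) + - (fromℕ 2 * χ (- a)) + fromℕ 2 * χ (- (fromℕ 2 * a))) * b)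
      ≡⟨ cong (λ t → - ((fromℕ 4 + χ (- 1#) + fromℕ 4 * χ (- (fromℕ 2 * a))) * t ^ 2)
                     + fromℕ 8 * ((fromℕ 4 + χ (- 1#) + - (fromℕ 2 * χ (- a)) + fromℕ 2 * χ (- (fromℕ 2 * a))) * b)) (sym a≡2h) ⟩
    - ((fromℕ 4 + χ (- 1#) + fromℕ 4 * χ (- (fromℕ 2 * a))) * a ^ 2)
      + fromℕ 8 * ((fromℕ 4 + χ (- 1#) + - (fromℕ 2 * χ (- a)) + fromℕ 2 * χ (- (fromℕ 2 * a))) * b)
      ∎

theorem1p3 : ∀ {ℓ : Level} (F : FiniteField ℓ) → let open FiniteField F in
    (p k : ℕ) → Prime p → k ≥ 1 → size ≡ p Data.Nat.^ k →
    size % 2 ≡ 1 → size > 5 →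
    (a b : Carrier) → ¬ (a ≡ 0#) →
    S (λ x → x ^ 4 + a * x ^ 2 + b)
      ≡ - (((fromℕ 4 + χ (- 1#) + fromℕ 4 * χ (- (fromℕ 2 * a))) * (fromℕ 64) ⁻¹) * a ^ 2)
        + ((fromℕ 4 + χ (- 1#) + - (fromℕ 2 * χ (- a)) + fromℕ 2 * χ (- (fromℕ 2 * a))) * (fromℕ 8) ⁻¹) * b
theorem1p3 F _ _ _ _ _ size-odd 5<size a b a≢0 = begin
  S f
    ≡⟨ sym (x⁻¹*[x*y]≡y (fromℕ 64) 64≢0 (S f)) ⟩
  fromℕ 64 ⁻¹ * (fromℕ 64 * S f)
    ≡⟨ cong (fromℕ 64 ⁻¹ *_) 64*S≡ ⟩
  fromℕ 64 ⁻¹ * (- (A * a ^ 2) + fromℕ 8 * (B * b))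
    ≡⟨ solve 5 (λ A B a b i → i :* (:- (A :* (a :* (a :* con ℤ.1ℤ))) :+ con (ℤ.+ 8) :* (B :* b))
               := :- ((A :* i) :* (a :* (a :* con ℤ.1ℤ))) :+ (B :* (con (ℤ.+ 8) :* i)) :* b) refl A B a b (fromℕ 64 ⁻¹) ⟩
  - ((A * fromℕ 64 ⁻¹) * a ^ 2) + (B * (fromℕ 8 * fromℕ 64 ⁻¹)) * b
    ≡⟨ cong (λ t → - ((A * fromℕ 64 ⁻¹) * a ^ 2) + (B * t) * b) (sym 8⁻¹≡8*64⁻¹) ⟩
  - ((A * fromℕ 64 ⁻¹) * a ^ 2) + (B * fromℕ 8 ⁻¹) * b ∎
  where
  open OddOrder F size-odd
  open QuarticValueSum F size-odd 5<size a b a≢0 using (f; 64*S≡)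
  open ≡-Reasoning
  A B : Carrier
  A = fromℕ 4 + χ (- 1#) + fromℕ 4 * χ (- (fromℕ 2 * a))
  B = fromℕ 4 + χ (- 1#) + - (fromℕ 2 * χ (- a)) + fromℕ 2 * χ (- (fromℕ 2 * a))
  8⁻¹≡8*64⁻¹ : fromℕ 8 ⁻¹ ≡ fromℕ 8 * fromℕ 64 ⁻¹
  8⁻¹≡8*64⁻¹ = sym (x*y≡1⇒y≡x⁻¹ (fromℕ 8) _ 8≢0
    (trans (solve 1 (λ i → con (ℤ.+ 8) :* (con (ℤ.+ 8) :* i) := con (ℤ.+ 64) :* i) refl _) (inverseʳ (fromℕ 64) 64≢0)))
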